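{- For integers $n\ge 0$, $k\ge 0$, $d\ge 0$ with $(n,k,d)\neq(0,0,1)$, \[ p_n^{(\mathrm{pk},\mathrm{des})}(k,d)+p_n^{(\mathrm{pk},\mathrm{des})}(k,d-1)=\sum_{l,i,j}\binom{n}{l}\, b_l^{(\mathrm{pk},\mathrm{des})}(i,j)\, b_{n-l}^{(\mathrm{pk},\mathrm{des})}(k-i,\,d-l+j), \] where the sum runs over all integers $l,i,j$.
   Context: For $\pi=\pi_1\cdots\pi_n\in\mathcal S_n$, a position $1\le i\le n-1$ is a descent if $\pi_i>\pi_{i+1}$ and an ascent if $\pi_i<\pi_{i+1}$; $\operatorname{des},\operatorname{asc}$ count them. A peak is a position $2\le i\le n-1$ with $\pi_{i-1}<\pi_i>\pi_{i+1}$; $\operatorname{pk}(\pi)$ is the number of peaks. $\pi$ is a ballot permutation if $\operatorname{asc}(\pi_1\cdots\pi_i)\ge\operatorname{des}(\pi_1\cdots\pi_i)$ for all $i\in[n]$; $\mathscr B_n$ is the set of ballot permutations of $[n]$, with $\mathscr B_0=\mathcal S_0=\{\epsilon\}$ (the empty permutation, with $\operatorname{pk}(\epsilon)=\operatorname{des}(\epsilon)=0$). $p_n^{(\mathrm{pk},\mathrm{des})}(k,d)$ is the number of $\pi\in\mathcal S_n$ with $\operatorname{pk}(\pi)=k$ and $\operatorname{des}(\pi)=d$, and $b_n^{(\mathrm{pk},\mathrm{des})}(k,d)$ the number of $\pi\in\mathscr B_n$ with $\operatorname{pk}(\pi)=k$, $\operatorname{des}(\pi)=d$. These numbers are $0$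 if any of $n,k,d$ is negative; for $n=0$ they equal $1$ if $k=d=0$ and $0$ otherwise. $\binom{n}{l}=0$ unless $0\le l\le n$. -}

module Defs where

open import Data.Nat using (ℕ; zero; suc; _+_; _*_; _∸_; _<ᵇ_; _≤ᵇ_)
open import Data.Nat.Combinatorics using (_C_)
open import Data.Integer using (ℤ; +_)
open import Data.Bool using (Bool; true; false; _∧_; if_then_else_)
open import Data.List using (List; []; _∷_; map; concatMap; length; filterᵇ; take; upTo; applyUpTo; foldr)
open import Data.Nat.ListAction using (sum)
open import Relation.Binary.PropositionalEquality using (_≡_)
open import Relation.Nullary.Decidable using (⌊_⌋)
import Data.Integer as ℤ

insertions : ℕ → List ℕ → List (List ℕ)
insertions x []       = (x ∷ []) ∷ []
insertions x (y ∷ ys) = (x ∷ y ∷ ys) ∷ map (y ∷_) (insertions x ys)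

perms : List ℕ → List (List ℕ)
perms []       = [] ∷ []
perms (x ∷ xs) = concatMap (insertions x) (perms xs)

Sn : ℕ → List (List ℕ)
Sn n = perms (applyUpTo suc n)

des : List ℕ → ℕ
des []           = 0
des (x ∷ [])     = 0
des (x ∷ y ∷ ys) = (if y <ᵇ x then 1 else 0) + des (y ∷ ys)

asc : List ℕ → ℕ
asc []           = 0
asc (x ∷ [])     = 0
asc (x ∷ y ∷ ys) = (if x <ᵇ y then 1 else 0) + asc (y ∷ ys)

pk : List ℕ → ℕ
pk []               = 0
pk (x ∷ [])         = 0
pk (x ∷ y ∷ [])     = 0
pk (x ∷ y ∷ z ∷ zs) = (if (x <ᵇ y) ∧ (z <ᵇ y) then 1 else 0) + pk (y ∷ z ∷ zs)

isBallot : List ℕ → Bool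
isBallot π = foldr (λ i b → (des (take i π) ≤ᵇ asc (take i π)) ∧ b) true
                   (applyUpTo suc (length π))

Bn : ℕ → List (List ℕ)
Bn n = filterᵇ isBallot (Sn n)

hasPkDes : ℤ → ℤ → List ℕ → Bool
hasPkDes k d π = ⌊ ℤ._≟_ (+ pk π) k ⌋ ∧ ⌊ ℤ._≟_ (+ des π) d ⌋

p : ℕ → ℤ → ℤ → ℕ
p n k d = length (filterᵇ (hasPkDes k d) (Sn n))

b : ℕ → ℤ → ℤ → ℕ
b n k d = length (filterᵇ (hasPkDes k d) (Bn n))

Σ≤ : ℕ → (ℕ → ℕ) → ℕ
Σ≤ n f = sum (map f (upTo (suc n)))

{-# OPTIONS --safe #-}
module Submission where

-- Both sides count permutations π ∈ S_n. Cutting π = αβ after l letters, standardising the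
-- letters of each part and choosing which letters go left shows that
-- binom(n,l) b_l(i,j) b_{n-l}(i′,j′) counts the π whose reversed prefix αʳ and suffix β are
-- ballot with (pk, des) equal to (i, j) and (i′, j′). Summing over i and j keeps the cuts l at
-- which αʳ and β are ballot, pk αʳ + pk β = k and des β = d − l + des αʳ.
-- On the up-down word u of π, ballotness of αʳ says that the part of u before the cut is
-- coballot; such a word ends with a descent, so the peaks and descents of π split over the
-- cut, and the condition becomes des π = d or des π = d − 1 according as the letter of u at
-- the cut is a descent, or an ascent (or there is none, l = n). Finally every word is either
-- ballot or has exactly one descent cut with coballot prefix and ballot remainder, and it has
-- exactly one such ascent-or-end cut. Hence π is counted [pk π = k, des π = d] +
-- [pk π = k, des π = d − 1] times; only for the empty permutation does the second count fail,
-- which is the excluded case (n, k, d) = (0, 0, 1).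

open import Defs
open import Data.Bool using (Bool; true; false; _∧_; not; if_then_else_; T)
open import Data.Bool.Properties using (not-involutive; ∧-comm; ∧-identityʳ; ∧-zeroʳ)
open import Data.Empty using (⊥-elim)
open import Data.Unit using (tt)
open import Data.Integer as ℤ using (ℤ)
import Data.Integer.Properties as ℤ
open import Data.Integer.Properties using () renaming (_≟_ to _≟ℤ_)
open import Data.Integer.Tactic.RingSolver using () renaming (solve-∀ to solve-∀ℤ)
open import Data.List
  using (List; []; _∷_; _++_; map; concatMap; filterᵇ; foldr; length; reverse; take; drop; upTo; applyUpTo)
open import Data.List.Membership.Propositional using (_∈_)
open import Data.List.Properties
  using (map-++; map-∘; map-cong-local; map-applyUpTo; length-++; length-map; length-take; length-applyUpTo;
         take-all; drop-all; take-[]; drop-[]; take-map; foldr-cong; ʳ++-defn; unfold-reverse; reverse-map;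
         ++-identityʳ; take++drop≡id; length-reverse; drop-drop)
open import Data.List.Relation.Binary.Permutation.Propositional
  using (_↭_; ↭-refl; ↭-prep; ↭-swap; ↭-trans; ↭-sym; ↭⇒↭ₛ)
open import Data.List.Relation.Binary.Permutation.Propositional.Properties
  using (↭-length; ↭-reverse; All-resp-↭; ∈-resp-↭)
open import Data.List.Relation.Binary.Sublist.Propositional using (_⊆_; []; _∷_; _∷ʳ_; minimum; ⊆-refl)
open import Data.List.Relation.Binary.Sublist.Propositional.Properties using (All-resp-⊆)
open import Data.List.Relation.Unary.All using (All; []; _∷_)
import Data.List.Relation.Unary.All as All
import Data.List.Relation.Unary.All.Properties as All
open import Data.List.Relation.Unary.AllPairs using (AllPairs; []; _∷_)
import Data.List.Relation.Unary.AllPairs as AllPairs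
import Data.List.Relation.Unary.AllPairs.Properties as AllPairs
open import Data.List.Relation.Unary.Any using (here; there)
open import Data.List.Relation.Unary.Unique.Propositional using (Unique)
import Data.List.Relation.Unary.Unique.Propositional.Properties as Unique
open import Data.Nat
open import Data.Nat.Combinatorics using (_C_; nCk+nC[k+1]≡[n+1]C[k+1])
open import Data.Nat.ListAction using (sum)
open import Data.Nat.ListAction.Properties using (sum-++)
open import Data.Nat.Tactic.RingSolver using (solve-∀)
open import Data.Nat.Properties
open import Data.Product using (_×_; _,_; map₁; map₂)
open import Data.Sum using (inj₁; inj₂)
open import Function using (_∘_)
open import Relation.Binary.PropositionalEquality
open import Relation.Nullary using (¬_; Dec; yes; no)
open import Relation.Nullary.Decidable using (⌊_⌋)

open import Algebra.Properties.CommutativeSemigroup +-commutativeSemigroup using (interchange)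
open import Data.List.Relation.Binary.Permutation.Setoid.Properties (setoid ℕ) using (Unique-resp-↭)

private
  variable
    A B : Set

𝟙 : Bool → ℕ
𝟙 b = if b then 1 else 0

𝟙-∧ : (a b : Bool) → 𝟙 (a ∧ b) ≡ 𝟙 a * 𝟙 b
𝟙-∧ true  b = sym (+-identityʳ (𝟙 b))
𝟙-∧ false b = refl

𝟙≤1 : (b : Bool) → 𝟙 b ≤ 1
𝟙≤1 true  = ≤-refl
𝟙≤1 false = z≤n

𝟙-∧-∧-* : (b e₁ e₂ : Bool) (x : ℕ) → 𝟙 (b ∧ (e₁ ∧ e₂)) * x ≡ 𝟙 e₁ * (𝟙 e₂ * (𝟙 b * x))
𝟙-∧-∧-* b e₁ e₂ x = begin
  𝟙 (b ∧ (e₁ ∧ e₂)) * x               ≡⟨ cong (_* x) (trans (𝟙-∧ b (e₁ ∧ e₂)) (cong (𝟙 b *_) (𝟙-∧ e₁ e₂))) ⟩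
  𝟙 b * (𝟙 e₁ * 𝟙 e₂) * x             ≡⟨ rearrange (𝟙 b) (𝟙 e₁) (𝟙 e₂) x ⟩
  𝟙 e₁ * (𝟙 e₂ * (𝟙 b * x))           ∎
  where
  open ≡-Reasoning
  rearrange : ∀ b e₁ e₂ x → b * (e₁ * e₂) * x ≡ e₁ * (e₂ * (b * x))
  rearrange = solve-∀

∑ : List A → (A → ℕ) → ℕ
∑ xs f = sum (map f xs)

∑-++ : (xs ys : List A) (f : A → ℕ) → ∑ (xs ++ ys) f ≡ ∑ xs f + ∑ ys f
∑-++ xs ys f = trans (cong sum (map-++ f xs ys)) (sum-++ (map f xs) (map f ys))

∑-concatMap : (g : A → List B) (xs : List A) (f : B → ℕ) →
  ∑ (concatMap g xs) f ≡ ∑ xs (λ x → ∑ (g x) f)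
∑-concatMap g []       f = refl
∑-concatMap g (x ∷ xs) f =
  trans (∑-++ (g x) (concatMap g xs) f) (cong (∑ (g x) f +_) (∑-concatMap g xs f))

∑-map : (g : A → B) (xs : List A) (f : B → ℕ) → ∑ (map g xs) f ≡ ∑ xs (f ∘ g)
∑-map g []       f = refl
∑-map g (x ∷ xs) f = cong (f (g x) +_) (∑-map g xs f)

∑-cong : (xs : List A) {f g : A → ℕ} → (∀ x → f x ≡ g x) → ∑ xs f ≡ ∑ xs g
∑-cong []       f≗g = refl
∑-cong (x ∷ xs) f≗g = cong₂ _+_ (f≗g x) (∑-cong xs f≗g)

∑-congᴬ : {P : A → Set} {xs : List A} {f g : A → ℕ} →
  All P xs → (∀ x → P x → f x ≡ g x) → ∑ xs f ≡ ∑ xs g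
∑-congᴬ []         f≗g = refl
∑-congᴬ (px ∷ pxs) f≗g = cong₂ _+_ (f≗g _ px) (∑-congᴬ pxs f≗g)

∑-+ : (xs : List A) (f g : A → ℕ) → ∑ xs (λ x → f x + g x) ≡ ∑ xs f + ∑ xs g
∑-+ []       f g = refl
∑-+ (x ∷ xs) f g =
  trans (cong (f x + g x +_) (∑-+ xs f g)) (interchange (f x) (g x) (∑ xs f) (∑ xs g))

∑-*ˡ : (xs : List A) (c : ℕ) (f : A → ℕ) → ∑ xs (λ x → c * f x) ≡ c * ∑ xs f
∑-*ˡ []       c f = sym (*-zeroʳ c)
∑-*ˡ (x ∷ xs) c f = trans (cong (c * f x +_) (∑-*ˡ xs c f)) (sym (*-distribˡ-+ c (f x) (∑ xs f)))

∑-*ʳ : (xs : List A) (c : ℕ) (f : A → ℕ) → ∑ xs (λ x → f x * c) ≡ ∑ xs f * c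
∑-*ʳ xs c f = trans (∑-cong xs (λ x → *-comm (f x) c)) (trans (∑-*ˡ xs c f) (*-comm c (∑ xs f)))

∑-const : (xs : List A) (c : ℕ) → ∑ xs (λ _ → c) ≡ length xs * c
∑-const []       c = refl
∑-const (x ∷ xs) c = cong (c +_) (∑-const xs c)

∑-swap : (xs : List A) (ys : List B) (f : A → B → ℕ) →
  ∑ xs (λ x → ∑ ys (f x)) ≡ ∑ ys (λ y → ∑ xs (λ x → f x y))
∑-swap []       ys f = sym (trans (∑-const ys 0) (*-zeroʳ (length ys)))
∑-swap (x ∷ xs) ys f =
  trans (cong (∑ ys (f x) +_) (∑-swap xs ys f)) (sym (∑-+ ys (f x) (λ y → ∑ xs (λ x → f x y))))

∑-swap₃ : {L I J : Set} (xs : List A) (ls : List L) (is : List I) (js : List J) (f : A → L → I → J → ℕ) →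
  ∑ xs (λ x → ∑ ls (λ l → ∑ is (λ i → ∑ js (f x l i)))) ≡ ∑ ls (λ l → ∑ is (λ i → ∑ js (λ j → ∑ xs (λ x → f x l i j))))
∑-swap₃ xs ls is js f = begin
  ∑ xs (λ x → ∑ ls (λ l → ∑ is (λ i → ∑ js (f x l i))))
    ≡⟨ ∑-swap xs ls (λ x l → ∑ is (λ i → ∑ js (f x l i))) ⟩
  ∑ ls (λ l → ∑ xs (λ x → ∑ is (λ i → ∑ js (f x l i))))
    ≡⟨ ∑-cong ls (λ l → ∑-swap xs is (λ x i → ∑ js (f x l i))) ⟩
  ∑ ls (λ l → ∑ is (λ i → ∑ xs (λ x → ∑ js (f x l i))))
    ≡⟨ ∑-cong ls (λ l → ∑-cong is (λ i → ∑-swap xs js (λ x → f x l i))) ⟩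
  ∑ ls (λ l → ∑ is (λ i → ∑ js (λ j → ∑ xs (λ x → f x l i j))))
    ∎
  where open ≡-Reasoning

length-filterᵇ : (P : A → Bool) (xs : List A) → length (filterᵇ P xs) ≡ ∑ xs (𝟙 ∘ P)
length-filterᵇ P []       = refl
length-filterᵇ P (x ∷ xs) with P x
... | true  = cong suc (length-filterᵇ P xs)
... | false = length-filterᵇ P xs

∑-filterᵇ : (P : A → Bool) (xs : List A) (f : A → ℕ) → ∑ (filterᵇ P xs) f ≡ ∑ xs (λ x → 𝟙 (P x) * f x)
∑-filterᵇ P []       f = refl
∑-filterᵇ P (x ∷ xs) f with P x
... | true  = cong₂ _+_ (sym (+-identityʳ (f x))) (∑-filterᵇ P xs f)
... | false = ∑-filterᵇ P xs f

∑-upTo-suc : (m : ℕ) (h : ℕ → ℕ) → ∑ (upTo (suc m)) h ≡ h 0 + ∑ (upTo m) (h ∘ suc)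
∑-upTo-suc m h = cong (λ xs → h 0 + sum xs)
  (trans (map-applyUpTo suc h m) (sym (map-applyUpTo (λ i → i) (h ∘ suc) m)))

∑-upTo-cong : (m : ℕ) {f g : ℕ → ℕ} → (∀ i → i < m → f i ≡ g i) → ∑ (upTo m) f ≡ ∑ (upTo m) g
∑-upTo-cong zero    f≗g = refl
∑-upTo-cong (suc m) {f} {g} f≗g = begin
  ∑ (upTo (suc m)) f          ≡⟨ ∑-upTo-suc m f ⟩
  f 0 + ∑ (upTo m) (f ∘ suc)  ≡⟨ cong₂ _+_ (f≗g 0 z<s) (∑-upTo-cong m (λ i i<m → f≗g (suc i) (s<s i<m))) ⟩
  g 0 + ∑ (upTo m) (g ∘ suc)  ≡⟨ ∑-upTo-suc m g ⟨
  ∑ (upTo (suc m)) g          ∎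
  where open ≡-Reasoning

∑-upTo-δ : (m a : ℕ) (f : ℕ → ℕ) → a < m → ∑ (upTo m) (λ i → 𝟙 (a ≡ᵇ i) * f i) ≡ f a
∑-upTo-δ (suc m) zero f _ = begin
  ∑ (upTo (suc m)) (λ i → 𝟙 (0 ≡ᵇ i) * f i)  ≡⟨ ∑-upTo-suc m _ ⟩
  f 0 + 0 + ∑ (upTo m) (λ _ → 0)            ≡⟨ cong (f 0 + 0 +_) (trans (∑-const (upTo m) 0) (*-zeroʳ (length (upTo m)))) ⟩
  f 0 + 0 + 0                               ≡⟨ trans (+-identityʳ _) (+-identityʳ _) ⟩
  f 0                                       ∎
  where open ≡-Reasoning
∑-upTo-δ (suc m) (suc a) f (s<s a<m) =
  trans (∑-upTo-suc m (λ i → 𝟙 (suc a ≡ᵇ i) * f i)) (∑-upTo-δ m a (f ∘ suc) a<m)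

cut : ℕ → (List A → List A → ℕ) → List A → ℕ
cut l G π = G (take l π) (drop l π)

insertions-↭ : (x : ℕ) (ys : List ℕ) → All (_↭ x ∷ ys) (insertions x ys)
insertions-↭ x []       = ↭-refl ∷ []
insertions-↭ x (y ∷ ys) =
  ↭-refl ∷ All.map⁺ (All.map (λ p → ↭-trans (↭-prep y p) (↭-swap y x ↭-refl)) (insertions-↭ x ys))

perms-↭ : (V : List ℕ) → All (_↭ V) (perms V)
perms-↭ []       = ↭-refl ∷ []
perms-↭ (x ∷ xs) = All.concat⁺ (All.map⁺
  (All.map (λ {π} π↭xs → All.map (λ ι↭ → ↭-trans ι↭ (↭-prep x π↭xs)) (insertions-↭ x π)) (perms-↭ xs)))

∑-perms-∷ : (x : ℕ) (xs : List ℕ) (h : List ℕ → ℕ) →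
  ∑ (perms (x ∷ xs)) h ≡ ∑ (perms xs) (λ π → ∑ (insertions x π) h)
∑-perms-∷ x xs h = ∑-concatMap (insertions x) (perms xs) h

∑-insertions-map : (f : ℕ → ℕ) (x : ℕ) (π : List ℕ) (h : List ℕ → ℕ) →
  ∑ (insertions (f x) (map f π)) h ≡ ∑ (insertions x π) (h ∘ map f)
∑-insertions-map f x []       h = refl
∑-insertions-map f x (y ∷ ys) h = cong (h (f x ∷ f y ∷ map f ys) +_) (begin
  ∑ (map (f y ∷_) (insertions (f x) (map f ys))) h  ≡⟨ ∑-map (f y ∷_) (insertions (f x) (map f ys)) h ⟩
  ∑ (insertions (f x) (map f ys)) (h ∘ (f y ∷_))    ≡⟨ ∑-insertions-map f x ys (h ∘ (f y ∷_)) ⟩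
  ∑ (insertions x ys) (h ∘ map f ∘ (y ∷_))          ≡⟨ ∑-map (y ∷_) (insertions x ys) (h ∘ map f) ⟨
  ∑ (map (y ∷_) (insertions x ys)) (h ∘ map f)      ∎)
  where open ≡-Reasoning

∑-perms-map : (f : ℕ → ℕ) (V : List ℕ) (h : List ℕ → ℕ) → ∑ (perms (map f V)) h ≡ ∑ (perms V) (h ∘ map f)
∑-perms-map f []       h = refl
∑-perms-map f (x ∷ xs) h = begin
  ∑ (perms (f x ∷ map f xs)) h                              ≡⟨ ∑-perms-∷ (f x) (map f xs) h ⟩
  ∑ (perms (map f xs)) (λ π → ∑ (insertions (f x) π) h)     ≡⟨ ∑-perms-map f xs (λ π → ∑ (insertions (f x) π) h) ⟩
  ∑ (perms xs) (λ π → ∑ (insertions (f x) (map f π)) h)     ≡⟨ ∑-cong (perms xs) (λ π → ∑-insertions-map f x π h) ⟩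
  ∑ (perms xs) (λ π → ∑ (insertions x π) (h ∘ map f))       ≡⟨ ∑-perms-∷ x xs (h ∘ map f) ⟨
  ∑ (perms (x ∷ xs)) (h ∘ map f)                            ∎
  where open ≡-Reasoning

∑-insertions-∷ʳ : (x y : ℕ) (zs : List ℕ) (g : List ℕ → ℕ) →
  ∑ (insertions x (zs ++ y ∷ [])) g ≡ ∑ (insertions x zs) (λ ι → g (ι ++ y ∷ [])) + g (zs ++ y ∷ x ∷ [])
∑-insertions-∷ʳ x y []       g = cong₂ _+_ (sym (+-identityʳ (g (x ∷ y ∷ [])))) (+-identityʳ (g (y ∷ x ∷ [])))
∑-insertions-∷ʳ x y (z ∷ zs) g = begin
  g (x ∷ z ∷ zs ++ y ∷ []) + ∑ (map (z ∷_) (insertions x (zs ++ y ∷ []))) g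
    ≡⟨ cong (g (x ∷ z ∷ zs ++ y ∷ []) +_)
         (trans (∑-map (z ∷_) (insertions x (zs ++ y ∷ [])) g) (∑-insertions-∷ʳ x y zs (g ∘ (z ∷_)))) ⟩
  g (x ∷ z ∷ zs ++ y ∷ []) + (∑ (insertions x zs) (λ ι → g (z ∷ ι ++ y ∷ [])) + g (z ∷ zs ++ y ∷ x ∷ []))
    ≡⟨ +-assoc (g (x ∷ z ∷ zs ++ y ∷ [])) _ _ ⟨
  g (x ∷ z ∷ zs ++ y ∷ []) + ∑ (insertions x zs) (λ ι → g (z ∷ ι ++ y ∷ [])) + g (z ∷ zs ++ y ∷ x ∷ [])
    ≡⟨ cong (λ t → g (x ∷ z ∷ zs ++ y ∷ []) + t + g (z ∷ zs ++ y ∷ x ∷ []))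
         (∑-map (z ∷_) (insertions x zs) (λ ι → g (ι ++ y ∷ []))) ⟨
  g (x ∷ z ∷ zs ++ y ∷ []) + ∑ (map (z ∷_) (insertions x zs)) (λ ι → g (ι ++ y ∷ [])) + g (z ∷ zs ++ y ∷ x ∷ [])
    ∎
  where open ≡-Reasoning

∑-insertions-reverse : (x : ℕ) (π : List ℕ) (g : List ℕ → ℕ) →
  ∑ (insertions x π) (g ∘ reverse) ≡ ∑ (insertions x (reverse π)) g
∑-insertions-reverse x []       g = refl
∑-insertions-reverse x (y ∷ ys) g = begin
  g (reverse (x ∷ y ∷ ys)) + ∑ (map (y ∷_) (insertions x ys)) (g ∘ reverse)
    ≡⟨ cong₂ _+_ (cong g (ʳ++-defn ys)) (∑-map (y ∷_) (insertions x ys) (g ∘ reverse)) ⟩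
  g (reverse ys ++ y ∷ x ∷ []) + ∑ (insertions x ys) (λ ι → g (reverse (y ∷ ι)))
    ≡⟨ cong (g (reverse ys ++ y ∷ x ∷ []) +_)
         (trans (∑-cong (insertions x ys) (λ ι → cong g (unfold-reverse y ι)))
                (∑-insertions-reverse x ys (λ ι → g (ι ++ y ∷ [])))) ⟩
  g (reverse ys ++ y ∷ x ∷ []) + ∑ (insertions x (reverse ys)) (λ ι → g (ι ++ y ∷ []))
    ≡⟨ +-comm (g (reverse ys ++ y ∷ x ∷ [])) _ ⟩
  ∑ (insertions x (reverse ys)) (λ ι → g (ι ++ y ∷ [])) + g (reverse ys ++ y ∷ x ∷ [])
    ≡⟨ ∑-insertions-∷ʳ x y (reverse ys) g ⟨
  ∑ (insertions x (reverse ys ++ y ∷ [])) g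
    ≡⟨ cong (λ l → ∑ (insertions x l) g) (unfold-reverse y ys) ⟨
  ∑ (insertions x (reverse (y ∷ ys))) g
    ∎
  where open ≡-Reasoning

∑-perms-reverse : (V : List ℕ) (h : List ℕ → ℕ) → ∑ (perms V) (h ∘ reverse) ≡ ∑ (perms V) h
∑-perms-reverse []       h = refl
∑-perms-reverse (x ∷ xs) h = begin
  ∑ (perms (x ∷ xs)) (h ∘ reverse)                          ≡⟨ ∑-perms-∷ x xs (h ∘ reverse) ⟩
  ∑ (perms xs) (λ π → ∑ (insertions x π) (h ∘ reverse))     ≡⟨ ∑-cong (perms xs) (λ π → ∑-insertions-reverse x π h) ⟩
  ∑ (perms xs) (λ π → ∑ (insertions x (reverse π)) h)       ≡⟨ ∑-perms-reverse xs (λ ρ → ∑ (insertions x ρ) h) ⟩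
  ∑ (perms xs) (λ π → ∑ (insertions x π) h)                 ≡⟨ ∑-perms-∷ x xs h ⟨
  ∑ (perms (x ∷ xs)) h                                      ∎
  where open ≡-Reasoning

AllPairs-resp-⊆ : {R : A → A → Set} {xs ys : List A} → xs ⊆ ys → AllPairs R ys → AllPairs R xs
AllPairs-resp-⊆ []           []            = []
AllPairs-resp-⊆ (_ ∷ʳ xs⊆)   (_ ∷ ys↑)     = AllPairs-resp-⊆ xs⊆ ys↑
AllPairs-resp-⊆ (refl ∷ xs⊆) (y<ys ∷ ys↑) = All-resp-⊆ xs⊆ y<ys ∷ AllPairs-resp-⊆ xs⊆ ys↑

applyUpTo-suc-sorted : (n : ℕ) → AllPairs _<_ (applyUpTo suc n)
applyUpTo-suc-sorted n = AllPairs.applyUpTo⁺₁ suc n (λ i<j _ → s<s i<j)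

Unique-reverse : {γ : List ℕ} → Unique γ → Unique (reverse γ)
Unique-reverse {γ} γ! = Unique-resp-↭ (↭⇒↭ₛ (↭-sym (↭-reverse γ))) γ!

Sn-unique-length : (n : ℕ) → All (λ π → Unique π × length π ≡ n) (Sn n)
Sn-unique-length n = All.map (λ π↭ → unique π↭ , trans (↭-length π↭) (length-applyUpTo suc n)) (perms-↭ (applyUpTo suc n))
  where
  unique : ∀ {π} → π ↭ applyUpTo suc n → Unique π
  unique π↭ = Unique-resp-↭ (↭⇒↭ₛ (↭-sym π↭)) (AllPairs.map <⇒≢ (applyUpTo-suc-sorted n))

-- Cutting a permutation in two

subsetSplits : ℕ → List A → List (List A × List A)
subsetSplits zero    V        = ([] , V) ∷ []
subsetSplits (suc l) []       = []
subsetSplits (suc l) (x ∷ xs) =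
  map (map₁ (x ∷_)) (subsetSplits l xs) ++ map (map₂ (x ∷_)) (subsetSplits (suc l) xs)

length-subsetSplits : (l : ℕ) (V : List A) → length (subsetSplits l V) ≡ length V C l
length-subsetSplits zero    V        = refl
length-subsetSplits (suc l) []       = refl
length-subsetSplits (suc l) (x ∷ xs) = begin
  length (map (map₁ (x ∷_)) (subsetSplits l xs) ++ map (map₂ (x ∷_)) (subsetSplits (suc l) xs))
    ≡⟨ length-++ (map (map₁ (x ∷_)) (subsetSplits l xs)) ⟩
  length (map (map₁ (x ∷_)) (subsetSplits l xs)) + length (map (map₂ (x ∷_)) (subsetSplits (suc l) xs))
    ≡⟨ cong₂ _+_ (trans (length-map _ (subsetSplits l xs)) (length-subsetSplits l xs))
                 (trans (length-map _ (subsetSplits (suc l) xs)) (length-subsetSplits (suc l) xs)) ⟩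
  length xs C l + length xs C suc l
    ≡⟨ nCk+nC[k+1]≡[n+1]C[k+1] (length xs) l ⟩
  suc (length xs) C suc l
    ∎
  where open ≡-Reasoning

subsetSplits-tooLarge : (l : ℕ) (V : List A) → length V < l → subsetSplits l V ≡ []
subsetSplits-tooLarge (suc l) []       _         = refl
subsetSplits-tooLarge (suc l) (x ∷ xs) (s<s |xs|<l)
  rewrite subsetSplits-tooLarge l xs |xs|<l
        | subsetSplits-tooLarge (suc l) xs (m<n⇒m<1+n |xs|<l) = refl

IsSplit : ℕ → List A → List A × List A → Set
IsSplit l V (A , B) = A ⊆ V × B ⊆ V × length A ≡ l × length A + length B ≡ length V

subsetSplits-IsSplit : (l : ℕ) (V : List A) → All (IsSplit l V) (subsetSplits l V)
subsetSplits-IsSplit zero    V        = (minimum V , ⊆-refl , refl , refl) ∷ []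
subsetSplits-IsSplit (suc l) []       = []
subsetSplits-IsSplit (suc l) (x ∷ xs) =
  All.++⁺ (All.map⁺ (All.map takeX (subsetSplits-IsSplit l xs)))
          (All.map⁺ (All.map leaveX (subsetSplits-IsSplit (suc l) xs)))
  where
  takeX : ∀ {AB} → IsSplit l xs AB → IsSplit (suc l) (x ∷ xs) (map₁ (x ∷_) AB)
  takeX (A⊆ , B⊆ , |A| , |A|+|B|) = refl ∷ A⊆ , x ∷ʳ B⊆ , cong suc |A| , cong suc |A|+|B|
  leaveX : ∀ {AB} → IsSplit (suc l) xs AB → IsSplit (suc l) (x ∷ xs) (map₂ (x ∷_) AB)
  leaveX {A , B} (A⊆ , B⊆ , |A| , |A|+|B|) =
    x ∷ʳ A⊆ , refl ∷ B⊆ , |A| , trans (+-suc (length A) (length B)) (cong suc |A|+|B|)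

∑perms₂ : (List ℕ → List ℕ → ℕ) → List ℕ × List ℕ → ℕ
∑perms₂ G (A , B) = ∑ (perms A) (λ α → ∑ (perms B) (G α))

insertLeft insertRight : ℕ → (List ℕ → List ℕ → ℕ) → List ℕ → List ℕ → ℕ
insertLeft  x G α β = ∑ (insertions x α) (λ ι → G ι β)
insertRight x G α β = ∑ (insertions x β) (G α)

∑-insertions-cut : (G : List ℕ → List ℕ → ℕ) (x : ℕ) (π : List ℕ) (l : ℕ) → l < length π →
  ∑ (insertions x π) (cut (suc l) G) ≡ cut l (insertLeft x G) π + cut (suc l) (insertRight x G) π
∑-insertions-cut G x (y ∷ ys) zero    _ =
  cong₂ _+_ (sym (+-identityʳ (G (x ∷ []) (y ∷ ys)))) (∑-map (y ∷_) (insertions x ys) (cut 1 G))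
∑-insertions-cut G x (y ∷ ys) (suc l) (s<s l<) = begin
  G₀ + ∑ (map (y ∷_) (insertions x ys)) (cut (2 + l) G)
    ≡⟨ cong (G₀ +_) (trans (∑-map (y ∷_) (insertions x ys) (cut (2 + l) G))
                           (∑-insertions-cut (λ α β → G (y ∷ α) β) x ys l l<)) ⟩
  G₀ + (cut l (insertLeft x (λ α β → G (y ∷ α) β)) ys + cut (suc l) (insertRight x (λ α → G (y ∷ α))) ys)
    ≡⟨ +-assoc G₀ _ _ ⟨
  G₀ + cut l (insertLeft x (λ α β → G (y ∷ α) β)) ys + cut (suc l) (insertRight x (λ α → G (y ∷ α))) ys
    ≡⟨ cong (λ t → G₀ + t + cut (suc l) (insertRight x (λ α → G (y ∷ α))) ys)
            (∑-map (y ∷_) (insertions x (take l ys)) (λ ι → G ι (drop l ys))) ⟨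
  cut (suc l) (insertLeft x G) (y ∷ ys) + cut (2 + l) (insertRight x G) (y ∷ ys)
    ∎
  where
  open ≡-Reasoning
  G₀ = G (x ∷ y ∷ take l ys) (drop l ys)

∑-insertions-cut-end : (G : List ℕ → List ℕ → ℕ) (x : ℕ) (π : List ℕ) (l : ℕ) → l ≡ length π →
  ∑ (insertions x π) (cut (suc l) G) ≡ cut l (insertLeft x G) π
∑-insertions-cut-end G x π l refl = begin
  ∑ (insertions x π) (cut (suc (length π)) G)  ≡⟨ ∑-congᴬ (All.map ↭-length (insertions-↭ x π)) whole ⟩
  ∑ (insertions x π) (λ ι → G ι [])            ≡⟨ cong₂ (insertLeft x G) (take-all _ π ≤-refl) (drop-all _ π ≤-refl) ⟨
  cut (length π) (insertLeft x G) π            ∎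
  where
  open ≡-Reasoning
  whole : ∀ ι → length ι ≡ suc (length π) → cut (suc (length π)) G ι ≡ G ι []
  whole ι |ι| = cong₂ G (take-all _ ι (≤-reflexive |ι|)) (drop-all _ ι (≤-reflexive |ι|))

-- Inserting the head x of V into π puts x among the first l + 1 positions, where it joins the
-- left part, or after them, where it joins the right part.
∑-perms-cut : (V : List ℕ) (l : ℕ) → l ≤ length V → (G : List ℕ → List ℕ → ℕ) →
  ∑ (perms V) (cut l G) ≡ ∑ (subsetSplits l V) (∑perms₂ G)
∑-perms-insertions-cut : (x : ℕ) (xs : List ℕ) (l : ℕ) → l ≤ length xs → (G : List ℕ → List ℕ → ℕ) →
  ∑ (perms xs) (λ π → ∑ (insertions x π) (cut (suc l) G))
    ≡ ∑ (subsetSplits l xs) (∑perms₂ (insertLeft x G)) + ∑ (subsetSplits (suc l) xs) (∑perms₂ (insertRight x G))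

∑-perms-cut V        zero    _       G = sym (trans (+-identityʳ _) (+-identityʳ _))
∑-perms-cut (x ∷ xs) (suc l) (s≤s l≤) G = begin
  ∑ (perms (x ∷ xs)) (cut (suc l) G)
    ≡⟨ ∑-perms-∷ x xs (cut (suc l) G) ⟩
  ∑ (perms xs) (λ π → ∑ (insertions x π) (cut (suc l) G))
    ≡⟨ ∑-perms-insertions-cut x xs l l≤ G ⟩
  ∑ (subsetSplits l xs) (∑perms₂ (insertLeft x G)) + ∑ (subsetSplits (suc l) xs) (∑perms₂ (insertRight x G))
    ≡⟨ cong₂ _+_ (∑-cong (subsetSplits l xs) left) (∑-cong (subsetSplits (suc l) xs) right) ⟩
  ∑ (subsetSplits l xs) (∑perms₂ G ∘ map₁ (x ∷_)) + ∑ (subsetSplits (suc l) xs) (∑perms₂ G ∘ map₂ (x ∷_))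
    ≡⟨ cong₂ _+_ (∑-map (map₁ (x ∷_)) (subsetSplits l xs) (∑perms₂ G))
                 (∑-map (map₂ (x ∷_)) (subsetSplits (suc l) xs) (∑perms₂ G)) ⟨
  ∑ (map (map₁ (x ∷_)) (subsetSplits l xs)) (∑perms₂ G) + ∑ (map (map₂ (x ∷_)) (subsetSplits (suc l) xs)) (∑perms₂ G)
    ≡⟨ ∑-++ (map (map₁ (x ∷_)) (subsetSplits l xs)) _ (∑perms₂ G) ⟨
  ∑ (subsetSplits (suc l) (x ∷ xs)) (∑perms₂ G)
    ∎
  where
  open ≡-Reasoning
  left : ∀ AB → ∑perms₂ (insertLeft x G) AB ≡ ∑perms₂ G (map₁ (x ∷_) AB)
  left (A , B) = sym (trans (∑-perms-∷ x A _)
    (∑-cong (perms A) (λ α → ∑-swap (insertions x α) (perms B) G)))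
  right : ∀ AB → ∑perms₂ (insertRight x G) AB ≡ ∑perms₂ G (map₂ (x ∷_) AB)
  right (A , B) = ∑-cong (perms A) (λ α → sym (∑-perms-∷ x B (G α)))

∑-perms-insertions-cut x xs l l≤ G with m≤n⇒m<n∨m≡n l≤
... | inj₁ l< = begin
  ∑ (perms xs) (λ π → ∑ (insertions x π) (cut (suc l) G))
    ≡⟨ ∑-congᴬ (All.map ↭-length (perms-↭ xs))
         (λ π |π| → ∑-insertions-cut G x π l (subst (l <_) (sym |π|) l<)) ⟩
  ∑ (perms xs) (λ π → cut l (insertLeft x G) π + cut (suc l) (insertRight x G) π)
    ≡⟨ ∑-+ (perms xs) _ _ ⟩
  ∑ (perms xs) (cut l (insertLeft x G)) + ∑ (perms xs) (cut (suc l) (insertRight x G))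
    ≡⟨ cong₂ _+_ (∑-perms-cut xs l l≤ (insertLeft x G)) (∑-perms-cut xs (suc l) l< (insertRight x G)) ⟩
  ∑ (subsetSplits l xs) (∑perms₂ (insertLeft x G)) + ∑ (subsetSplits (suc l) xs) (∑perms₂ (insertRight x G))
    ∎
  where open ≡-Reasoning
... | inj₂ refl = begin
  ∑ (perms xs) (λ π → ∑ (insertions x π) (cut (suc l) G))
    ≡⟨ ∑-congᴬ (All.map ↭-length (perms-↭ xs)) (λ π |π| → ∑-insertions-cut-end G x π l (sym |π|)) ⟩
  ∑ (perms xs) (cut l (insertLeft x G))
    ≡⟨ ∑-perms-cut xs l l≤ (insertLeft x G) ⟩
  ∑ (subsetSplits l xs) (∑perms₂ (insertLeft x G))
    ≡⟨ +-identityʳ _ ⟨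
  ∑ (subsetSplits l xs) (∑perms₂ (insertLeft x G)) + 0
    ≡⟨ cong (λ L → ∑ (subsetSplits l xs) (∑perms₂ (insertLeft x G)) + ∑ L (∑perms₂ (insertRight x G)))
         (subsetSplits-tooLarge (suc l) xs ≤-refl) ⟨
  ∑ (subsetSplits l xs) (∑perms₂ (insertLeft x G)) + ∑ (subsetSplits (suc l) xs) (∑perms₂ (insertRight x G))
    ∎
  where open ≡-Reasoning

-- Standardisation

<ᵇ-true : {m n : ℕ} → m < n → (m <ᵇ n) ≡ true
<ᵇ-true {zero}  {suc n} _         = refl
<ᵇ-true {suc m} {suc n} (s<s m<n) = <ᵇ-true m<n

<ᵇ-false : {m n : ℕ} → n ≤ m → (m <ᵇ n) ≡ false
<ᵇ-false {m}     {zero}  _         = refl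
<ᵇ-false {suc m} {suc n} (s≤s n≤m) = <ᵇ-false n≤m

≤ᵇ-true : {m n : ℕ} → m ≤ n → (m ≤ᵇ n) ≡ true
≤ᵇ-true {zero}  _   = refl
≤ᵇ-true {suc m} m≤n = <ᵇ-true m≤n

≤ᵇ-false : {m n : ℕ} → n < m → (m ≤ᵇ n) ≡ false
≤ᵇ-false {suc m} (s≤s n≤m) = <ᵇ-false n≤m

<ᵇ-suc : (m n : ℕ) → (m <ᵇ suc n) ≡ (m ≤ᵇ n)
<ᵇ-suc zero    n = refl
<ᵇ-suc (suc m) n = refl

<ᵇ-flip : (x y : ℕ) → x ≢ y → (y <ᵇ x) ≡ not (x <ᵇ y)
<ᵇ-flip zero    zero    x≢y = ⊥-elim (x≢y refl)
<ᵇ-flip zero    (suc y) _   = refl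
<ᵇ-flip (suc x) zero    _   = refl
<ᵇ-flip (suc x) (suc y) x≢y = <ᵇ-flip x y (x≢y ∘ cong suc)

≡ᵇ-+-cancelʳ : (m n t : ℕ) → (m + t ≡ᵇ n + t) ≡ (m ≡ᵇ n)
≡ᵇ-+-cancelʳ m n zero    rewrite +-identityʳ m | +-identityʳ n = refl
≡ᵇ-+-cancelʳ m n (suc t) rewrite +-suc m t | +-suc n t = ≡ᵇ-+-cancelʳ m n t

pk≤length : (γ : List ℕ) → pk γ ≤ length γ
pk≤length []               = z≤n
pk≤length (x ∷ [])         = z≤n
pk≤length (x ∷ y ∷ [])     = z≤n
pk≤length (x ∷ y ∷ z ∷ zs) = +-mono-≤ (𝟙≤1 ((x <ᵇ y) ∧ (z <ᵇ y))) (pk≤length (y ∷ z ∷ zs))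

des≤length : (γ : List ℕ) → des γ ≤ length γ
des≤length []           = z≤n
des≤length (x ∷ [])     = z≤n
des≤length (x ∷ y ∷ ys) = +-mono-≤ (𝟙≤1 (y <ᵇ x)) (des≤length (y ∷ ys))

rank : List ℕ → ℕ → ℕ
rank A y = ∑ A (λ a → 𝟙 (a ≤ᵇ y))

rank-below : (A : List ℕ) {y : ℕ} → All (y <_) A → rank A y ≡ 0
rank-below []      []           = refl
rank-below (a ∷ A) (y<a ∷ y<A) rewrite ≤ᵇ-false y<a = rank-below A y<A

rank-sorted : (A : List ℕ) → AllPairs _<_ A → map (rank A) A ≡ applyUpTo suc (length A)
rank-sorted []      []            = refl
rank-sorted (a ∷ A) (a<A ∷ A↑) = cong₂ _∷_ rank-a (begin
  map (rank (a ∷ A)) A                ≡⟨ map-cong-local (All.map (λ a<z → cong (_+ _) (cong 𝟙 (≤ᵇ-true (<⇒≤ a<z)))) a<A) ⟩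
  map (suc ∘ rank A) A                ≡⟨ map-∘ A ⟩
  map suc (map (rank A) A)            ≡⟨ cong (map suc) (rank-sorted A A↑) ⟩
  map suc (applyUpTo suc (length A))  ≡⟨ map-applyUpTo suc suc (length A) ⟩
  applyUpTo (suc ∘ suc) (length A)    ∎)
  where
  open ≡-Reasoning
  rank-a : rank (a ∷ A) a ≡ 1
  rank-a rewrite ≤ᵇ-true (≤-refl {a}) | rank-below A a<A = refl

𝟙-≤ᵇ-mono : (a : ℕ) {y z : ℕ} → y ≤ z → 𝟙 (a ≤ᵇ y) ≤ 𝟙 (a ≤ᵇ z)
𝟙-≤ᵇ-mono a {y} y≤z with a ≤? y
... | yes a≤y rewrite ≤ᵇ-true a≤y | ≤ᵇ-true (≤-trans a≤y y≤z) = ≤-refl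
... | no  a≰y rewrite ≤ᵇ-false (≰⇒> a≰y) = z≤n

rank-mono : (A : List ℕ) {y z : ℕ} → y ≤ z → rank A y ≤ rank A z
rank-mono []      _   = z≤n
rank-mono (a ∷ A) y≤z = +-mono-≤ (𝟙-≤ᵇ-mono a y≤z) (rank-mono A y≤z)

rank-strict : (A : List ℕ) {y z : ℕ} → y < z → z ∈ A → rank A y < rank A z
rank-strict (a ∷ A) {y} {z} y<z (here refl)
  rewrite ≤ᵇ-false y<z | ≤ᵇ-true (≤-refl {z}) = s≤s (rank-mono A (<⇒≤ y<z))
rank-strict (a ∷ A) y<z (there z∈A) = +-mono-≤-< (𝟙-≤ᵇ-mono a (<⇒≤ y<z)) (rank-strict A y<z z∈A)

PreservesOrderOn : (ℕ → ℕ) → List ℕ → Set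
PreservesOrderOn f A = ∀ {y z} → y ∈ A → z ∈ A → (y <ᵇ z) ≡ (f y <ᵇ f z)

rank-preservesOrder : (A : List ℕ) → PreservesOrderOn (rank A) A
rank-preservesOrder A {y} {z} _ z∈A with y <? z
... | yes y<z = trans (<ᵇ-true y<z) (sym (<ᵇ-true (rank-strict A y<z z∈A)))
... | no  y≮z = trans (<ᵇ-false (≮⇒≥ y≮z)) (sym (<ᵇ-false (rank-mono A (≮⇒≥ y≮z))))

module _ {f : ℕ → ℕ} {A : List ℕ} (f↑ : PreservesOrderOn f A) where

  des-map : (γ : List ℕ) → All (_∈ A) γ → des (map f γ) ≡ des γ
  des-map []           _                  = refl
  des-map (x ∷ [])     _                  = refl
  des-map (x ∷ y ∷ ys) (x∈ ∷ y∈ ∷ ys∈) =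
    cong₂ _+_ (cong 𝟙 (sym (f↑ y∈ x∈))) (des-map (y ∷ ys) (y∈ ∷ ys∈))

  asc-map : (γ : List ℕ) → All (_∈ A) γ → asc (map f γ) ≡ asc γ
  asc-map []           _                  = refl
  asc-map (x ∷ [])     _                  = refl
  asc-map (x ∷ y ∷ ys) (x∈ ∷ y∈ ∷ ys∈) =
    cong₂ _+_ (cong 𝟙 (sym (f↑ x∈ y∈))) (asc-map (y ∷ ys) (y∈ ∷ ys∈))

  pk-map : (γ : List ℕ) → All (_∈ A) γ → pk (map f γ) ≡ pk γ
  pk-map []               _                        = refl
  pk-map (x ∷ [])         _                        = refl
  pk-map (x ∷ y ∷ [])     _                        = refl
  pk-map (x ∷ y ∷ z ∷ zs) (x∈ ∷ y∈ ∷ z∈ ∷ zs∈) =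
    cong₂ _+_ (cong 𝟙 (sym (cong₂ _∧_ (f↑ x∈ y∈) (f↑ z∈ y∈)))) (pk-map (y ∷ z ∷ zs) (y∈ ∷ z∈ ∷ zs∈))

  isBallot-map : (γ : List ℕ) → All (_∈ A) γ → isBallot (map f γ) ≡ isBallot γ
  isBallot-map γ γ∈ = begin
    isBallot (map f γ)
      ≡⟨ cong (λ m → foldr (λ i b → (des (take i (map f γ)) ≤ᵇ asc (take i (map f γ))) ∧ b) true (applyUpTo suc m))
              (length-map f γ) ⟩
    foldr (λ i b → (des (take i (map f γ)) ≤ᵇ asc (take i (map f γ))) ∧ b) true (applyUpTo suc (length γ))
      ≡⟨ foldr-cong (λ i b → cong (_∧ b) (prefix i)) refl (applyUpTo suc (length γ)) ⟩
    isBallot γ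
      ∎
    where
    open ≡-Reasoning
    prefix : ∀ i → (des (take i (map f γ)) ≤ᵇ asc (take i (map f γ))) ≡ (des (take i γ) ≤ᵇ asc (take i γ))
    prefix i rewrite take-map {f = f} i γ =
      cong₂ _≤ᵇ_ (des-map (take i γ) (All.take⁺ i γ∈)) (asc-map (take i γ) (All.take⁺ i γ∈))

RelabelInvariant : (List ℕ → ℕ) → Set
RelabelInvariant Φ = ∀ {f A} → PreservesOrderOn f A → (γ : List ℕ) → All (_∈ A) γ → Φ (map f γ) ≡ Φ γ

RelabelInvariant-reverse : {Φ : List ℕ → ℕ} → RelabelInvariant Φ → RelabelInvariant (Φ ∘ reverse)
RelabelInvariant-reverse {Φ} inv f↑ γ γ∈ =
  trans (cong Φ (sym (reverse-map _ γ))) (inv f↑ (reverse γ) (All-resp-↭ (↭-sym (↭-reverse γ)) γ∈))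

∑-perms-standardize : (Φ : List ℕ → ℕ) → RelabelInvariant Φ →
  (A : List ℕ) → AllPairs _<_ A → ∑ (perms A) Φ ≡ ∑ (Sn (length A)) Φ
∑-perms-standardize Φ inv A A↑ = begin
  ∑ (perms A) Φ                   ≡⟨ ∑-congᴬ (perms-↭ A) relabel ⟨
  ∑ (perms A) (Φ ∘ map (rank A))  ≡⟨ ∑-perms-map (rank A) A Φ ⟨
  ∑ (perms (map (rank A) A)) Φ    ≡⟨ cong (λ V → ∑ (perms V) Φ) (rank-sorted A A↑) ⟩
  ∑ (Sn (length A)) Φ             ∎
  where
  open ≡-Reasoning
  relabel : ∀ γ → γ ↭ A → Φ (map (rank A) γ) ≡ Φ γ
  relabel γ γ↭A = inv (rank-preservesOrder A) γ (All.tabulate (∈-resp-↭ γ↭A))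

isBallotWith : ℤ → ℤ → List ℕ → Bool
isBallotWith i j γ = isBallot γ ∧ hasPkDes i j γ

isBallotWith-relabel : (i j : ℤ) → RelabelInvariant (𝟙 ∘ isBallotWith i j)
isBallotWith-relabel i j f↑ γ γ∈ = cong 𝟙 (cong₂ _∧_ (isBallot-map f↑ γ γ∈)
  (cong₂ (λ p d → ⌊ ℤ.+ p ≟ℤ i ⌋ ∧ ⌊ ℤ.+ d ≟ℤ j ⌋) (pk-map f↑ γ γ∈) (des-map f↑ γ γ∈)))

p-as-∑ : (n : ℕ) (k d : ℤ) → p n k d ≡ ∑ (Sn n) (𝟙 ∘ hasPkDes k d)
p-as-∑ n k d = length-filterᵇ (hasPkDes k d) (Sn n)

b-as-∑ : (l : ℕ) (i j : ℤ) → b l i j ≡ ∑ (Sn l) (𝟙 ∘ isBallotWith i j)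
b-as-∑ l i j = begin
  length (filterᵇ (hasPkDes i j) (filterᵇ isBallot (Sn l)))  ≡⟨ length-filterᵇ (hasPkDes i j) (filterᵇ isBallot (Sn l)) ⟩
  ∑ (filterᵇ isBallot (Sn l)) (𝟙 ∘ hasPkDes i j)            ≡⟨ ∑-filterᵇ isBallot (Sn l) (𝟙 ∘ hasPkDes i j) ⟩
  ∑ (Sn l) (λ γ → 𝟙 (isBallot γ) * 𝟙 (hasPkDes i j γ))      ≡⟨ ∑-cong (Sn l) (λ γ → 𝟙-∧ (isBallot γ) (hasPkDes i j γ)) ⟨
  ∑ (Sn l) (𝟙 ∘ isBallotWith i j)                           ∎
  where open ≡-Reasoning

b-as-∑-reverse : (l : ℕ) (i j : ℤ) → b l i j ≡ ∑ (Sn l) (𝟙 ∘ isBallotWith i j ∘ reverse)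
b-as-∑-reverse l i j = trans (b-as-∑ l i j) (sym (∑-perms-reverse (applyUpTo suc l) (𝟙 ∘ isBallotWith i j)))

ballotPair : ℤ → ℤ → ℤ → ℤ → List ℕ → List ℕ → ℕ
ballotPair i j i′ j′ α β = 𝟙 (isBallotWith i j (reverse α)) * 𝟙 (isBallotWith i′ j′ β)

∑perms₂-* : (f g : List ℕ → ℕ) (A B : List ℕ) →
  ∑perms₂ (λ α β → f α * g β) (A , B) ≡ ∑ (perms A) f * ∑ (perms B) g
∑perms₂-* f g A B =
  trans (∑-cong (perms A) (λ α → ∑-*ˡ (perms B) (f α) g)) (∑-*ʳ (perms A) (∑ (perms B) g) f)

∑perms₂-ballotPair : (i j i′ j′ : ℤ) (A B : List ℕ) → AllPairs _<_ A → AllPairs _<_ B →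
  ∑perms₂ (ballotPair i j i′ j′) (A , B) ≡ b (length A) i j * b (length B) i′ j′
∑perms₂-ballotPair i j i′ j′ A B A↑ B↑ = begin
  ∑perms₂ (ballotPair i j i′ j′) (A , B)
    ≡⟨ ∑perms₂-* (𝟙 ∘ isBallotWith i j ∘ reverse) (𝟙 ∘ isBallotWith i′ j′) A B ⟩
  ∑ (perms A) (𝟙 ∘ isBallotWith i j ∘ reverse) * ∑ (perms B) (𝟙 ∘ isBallotWith i′ j′)
    ≡⟨ cong₂ _*_ (∑-perms-standardize _ (RelabelInvariant-reverse (isBallotWith-relabel i j)) A A↑)
                 (∑-perms-standardize _ (isBallotWith-relabel i′ j′) B B↑) ⟩
  ∑ (Sn (length A)) (𝟙 ∘ isBallotWith i j ∘ reverse) * ∑ (Sn (length B)) (𝟙 ∘ isBallotWith i′ j′)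
    ≡⟨ cong₂ _*_ (b-as-∑-reverse (length A) i j) (b-as-∑ (length B) i′ j′) ⟨
  b (length A) i j * b (length B) i′ j′
    ∎
  where open ≡-Reasoning

ballot-product : (n l : ℕ) → l ≤ n → (i j i′ j′ : ℤ) →
  (n C l) * b l i j * b (n ∸ l) i′ j′ ≡ ∑ (Sn n) (cut l (ballotPair i j i′ j′))
ballot-product n l l≤n i j i′ j′ = begin
  (n C l) * b l i j * b (n ∸ l) i′ j′
    ≡⟨ *-assoc (n C l) (b l i j) (b (n ∸ l) i′ j′) ⟩
  (n C l) * (b l i j * b (n ∸ l) i′ j′)
    ≡⟨ cong (λ m → (m C l) * (b l i j * b (n ∸ l) i′ j′)) (length-applyUpTo suc n) ⟨
  (length [n] C l) * (b l i j * b (n ∸ l) i′ j′)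
    ≡⟨ cong (_* (b l i j * b (n ∸ l) i′ j′)) (length-subsetSplits l [n]) ⟨
  length (subsetSplits l [n]) * (b l i j * b (n ∸ l) i′ j′)
    ≡⟨ ∑-const (subsetSplits l [n]) (b l i j * b (n ∸ l) i′ j′) ⟨
  ∑ (subsetSplits l [n]) (λ _ → b l i j * b (n ∸ l) i′ j′)
    ≡⟨ ∑-congᴬ (subsetSplits-IsSplit l [n]) perSplit ⟨
  ∑ (subsetSplits l [n]) (∑perms₂ (ballotPair i j i′ j′))
    ≡⟨ ∑-perms-cut [n] l (subst (l ≤_) (sym (length-applyUpTo suc n)) l≤n) (ballotPair i j i′ j′) ⟨
  ∑ (Sn n) (cut l (ballotPair i j i′ j′))
    ∎
  where
  open ≡-Reasoning
  [n] = applyUpTo suc n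
  perSplit : ∀ AB → IsSplit l [n] AB → ∑perms₂ (ballotPair i j i′ j′) AB ≡ b l i j * b (n ∸ l) i′ j′
  perSplit (A , B) (A⊆ , B⊆ , |A| , |A|+|B|) =
    trans (∑perms₂-ballotPair i j i′ j′ A B (AllPairs-resp-⊆ A⊆ [n]↑) (AllPairs-resp-⊆ B⊆ [n]↑))
          (cong₂ (λ a b′ → b a i j * b b′ i′ j′) |A| |B|)
    where
    [n]↑ = applyUpTo-suc-sorted n
    |B| : length B ≡ n ∸ l
    |B| = begin
      length B                        ≡⟨ m+n∸m≡n (length A) (length B) ⟨
      length A + length B ∸ length A  ≡⟨ cong₂ _∸_ (trans |A|+|B| (length-applyUpTo suc n)) |A| ⟩
      n ∸ l                           ∎

-- Up-down words

updown : List ℕ → List Bool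
updown []           = []
updown (x ∷ [])     = []
updown (x ∷ y ∷ ys) = (x <ᵇ y) ∷ updown (y ∷ ys)

ups downs peaks : List Bool → ℕ
ups []       = 0
ups (c ∷ cs) = 𝟙 c + ups cs
downs []       = 0
downs (c ∷ cs) = 𝟙 (not c) + downs cs
peaks []             = 0
peaks (c ∷ [])       = 0
peaks (c ∷ c′ ∷ cs)  = 𝟙 (c ∧ not c′) + peaks (c′ ∷ cs)

ballotFrom : ℕ → List Bool → Bool
ballotFrom h       []          = true
ballotFrom h       (true ∷ u)  = ballotFrom (suc h) u
ballotFrom zero    (false ∷ u) = false
ballotFrom (suc h) (false ∷ u) = ballotFrom h u

asc-updown : (π : List ℕ) → asc π ≡ ups (updown π)
asc-updown []           = refl
asc-updown (x ∷ [])     = refl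
asc-updown (x ∷ y ∷ ys) = cong (𝟙 (x <ᵇ y) +_) (asc-updown (y ∷ ys))

des-updown : (π : List ℕ) → Unique π → des π ≡ downs (updown π)
des-updown []           _                   = refl
des-updown (x ∷ [])     _                   = refl
des-updown (x ∷ y ∷ ys) ((x≢y ∷ _) ∷ yys!) =
  cong₂ _+_ (cong 𝟙 (<ᵇ-flip x y x≢y)) (des-updown (y ∷ ys) yys!)

pk-updown : (π : List ℕ) → Unique π → pk π ≡ peaks (updown π)
pk-updown []               _                       = refl
pk-updown (x ∷ [])         _                       = refl
pk-updown (x ∷ y ∷ [])     _                       = refl
pk-updown (x ∷ y ∷ z ∷ zs) (_ ∷ yzzs!@((y≢z ∷ _) ∷ _)) =
  cong₂ _+_ (cong (λ c → 𝟙 ((x <ᵇ y) ∧ c)) (<ᵇ-flip y z y≢z)) (pk-updown (y ∷ z ∷ zs) yzzs!)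

length-updown : (x : ℕ) (π : List ℕ) → length (updown (x ∷ π)) ≡ length π
length-updown x []       = refl
length-updown x (y ∷ ys) = cong suc (length-updown y ys)

updown-take : (i : ℕ) (π : List ℕ) → updown (take (suc i) π) ≡ take i (updown π)
updown-take i       []           = sym (take-[] i)
updown-take zero    (x ∷ [])     = refl
updown-take (suc i) (x ∷ [])     = refl
updown-take zero    (x ∷ y ∷ ys) = refl
updown-take (suc i) (x ∷ y ∷ ys) = cong ((x <ᵇ y) ∷_) (updown-take i (y ∷ ys))

updown-drop : (i : ℕ) (π : List ℕ) → updown (drop i π) ≡ drop i (updown π)
updown-drop zero    π            = refl
updown-drop (suc i) []           = refl
updown-drop (suc i) (x ∷ [])     = cong updown (drop-[] i)
updown-drop (suc i) (x ∷ y ∷ ys) = updown-drop i (y ∷ ys)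

reverseNot : List Bool → List Bool
reverseNot v = reverse (map not v)

reverseNot-∷ : (c : Bool) (v : List Bool) → reverseNot (c ∷ v) ≡ reverseNot v ++ not c ∷ []
reverseNot-∷ c v = unfold-reverse (not c) (map not v)

updown-∷ʳ : (ρ : List ℕ) (y x : ℕ) → updown (ρ ++ y ∷ x ∷ []) ≡ updown (ρ ++ y ∷ []) ++ (y <ᵇ x) ∷ []
updown-∷ʳ []           y x = refl
updown-∷ʳ (r ∷ [])     y x = refl
updown-∷ʳ (r ∷ s ∷ ρ) y x = cong ((r <ᵇ s) ∷_) (updown-∷ʳ (s ∷ ρ) y x)

updown-reverse : (π : List ℕ) → Unique π → updown (reverse π) ≡ reverseNot (updown π)
updown-reverse []           _                   = refl
updown-reverse (x ∷ [])     _                   = refl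
updown-reverse (x ∷ y ∷ ys) ((x≢y ∷ _) ∷ yys!) = begin
  updown (reverse (x ∷ y ∷ ys))                       ≡⟨ cong updown (ʳ++-defn ys) ⟩
  updown (reverse ys ++ y ∷ x ∷ [])                   ≡⟨ updown-∷ʳ (reverse ys) y x ⟩
  updown (reverse ys ++ y ∷ []) ++ (y <ᵇ x) ∷ []      ≡⟨ cong₂ (λ v c → v ++ c ∷ []) reversed (<ᵇ-flip x y x≢y) ⟩
  reverseNot (updown (y ∷ ys)) ++ not (x <ᵇ y) ∷ []   ≡⟨ reverseNot-∷ (x <ᵇ y) (updown (y ∷ ys)) ⟨
  reverseNot (updown (x ∷ y ∷ ys))                    ∎
  where
  open ≡-Reasoning
  reversed : updown (reverse ys ++ y ∷ []) ≡ reverseNot (updown (y ∷ ys))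
  reversed = trans (cong updown (sym (unfold-reverse y ys))) (updown-reverse (y ∷ ys) yys!)

allUpTo : ℕ → (ℕ → Bool) → Bool
allUpTo zero    Q = true
allUpTo (suc m) Q = Q 0 ∧ allUpTo m (Q ∘ suc)

allUpTo-cong : (m : ℕ) {P Q : ℕ → Bool} → (∀ i → P i ≡ Q i) → allUpTo m P ≡ allUpTo m Q
allUpTo-cong zero    P≗Q = refl
allUpTo-cong (suc m) P≗Q = cong₂ _∧_ (P≗Q 0) (allUpTo-cong m (P≗Q ∘ suc))

foldr-∧-applyUpTo : (f : ℕ → ℕ) (Q : ℕ → Bool) (m : ℕ) →
  foldr (λ i b → Q i ∧ b) true (applyUpTo f m) ≡ allUpTo m (Q ∘ f)
foldr-∧-applyUpTo f Q zero    = refl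
foldr-∧-applyUpTo f Q (suc m) = cong (Q (f 0) ∧_) (foldr-∧-applyUpTo (f ∘ suc) Q m)

ballotFrom-prefixes : (h : ℕ) (u : List Bool) →
  ballotFrom h u ≡ allUpTo (suc (length u)) (λ i → downs (take i u) ≤ᵇ h + ups (take i u))
ballotFrom-prefixes h       []          = refl
ballotFrom-prefixes h       (true ∷ u)  = trans (ballotFrom-prefixes (suc h) u)
  (allUpTo-cong (suc (length u)) (λ i → cong (downs (take i u) ≤ᵇ_) (sym (+-suc h (ups (take i u))))))
ballotFrom-prefixes zero    (false ∷ u) = refl
ballotFrom-prefixes (suc h) (false ∷ u) = trans (ballotFrom-prefixes h u)
  (allUpTo-cong (suc (length u)) (λ i → sym (<ᵇ-suc (downs (take i u)) (h + ups (take i u)))))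

isBallot-updown : (π : List ℕ) → Unique π → isBallot π ≡ ballotFrom 0 (updown π)
isBallot-updown []      _  = refl
isBallot-updown (x ∷ π) π! = begin
  isBallot (x ∷ π)
    ≡⟨ foldr-∧-applyUpTo suc (λ i → des (take i (x ∷ π)) ≤ᵇ asc (take i (x ∷ π))) (suc (length π)) ⟩
  allUpTo (suc (length π)) (λ i → des (take (suc i) (x ∷ π)) ≤ᵇ asc (take (suc i) (x ∷ π)))
    ≡⟨ allUpTo-cong (suc (length π)) (λ i → cong₂ _≤ᵇ_ (des-prefix i) (asc-prefix i)) ⟩
  allUpTo (suc (length π)) (λ i → downs (take i u) ≤ᵇ ups (take i u))
    ≡⟨ cong (λ m → allUpTo (suc m) (λ i → downs (take i u) ≤ᵇ ups (take i u))) (length-updown x π) ⟨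
  allUpTo (suc (length u)) (λ i → downs (take i u) ≤ᵇ ups (take i u))
    ≡⟨ ballotFrom-prefixes 0 u ⟨
  ballotFrom 0 u
    ∎
  where
  open ≡-Reasoning
  u = updown (x ∷ π)
  des-prefix : ∀ i → des (take (suc i) (x ∷ π)) ≡ downs (take i u)
  des-prefix i = trans (des-updown (take (suc i) (x ∷ π)) (Unique.take⁺ (suc i) π!)) (cong downs (updown-take i (x ∷ π)))
  asc-prefix : ∀ i → asc (take (suc i) (x ∷ π)) ≡ ups (take i u)
  asc-prefix i = trans (asc-updown (take (suc i) (x ∷ π))) (cong ups (updown-take i (x ∷ π)))

-- Reversal and coballot words

ups+downs : (v : List Bool) → ups v + downs v ≡ length v
ups+downs []          = refl
ups+downs (true ∷ v)  = cong suc (ups+downs v)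
ups+downs (false ∷ v) = trans (+-suc (ups v) (downs v)) (cong suc (ups+downs v))

downs-++ : (xs ys : List Bool) → downs (xs ++ ys) ≡ downs xs + downs ys
downs-++ []       ys = refl
downs-++ (c ∷ xs) ys = trans (cong (𝟙 (not c) +_) (downs-++ xs ys)) (sym (+-assoc (𝟙 (not c)) _ _))

downs-reverseNot : (v : List Bool) → downs (reverseNot v) ≡ ups v
downs-reverseNot []      = refl
downs-reverseNot (c ∷ v) = begin
  downs (reverseNot (c ∷ v))             ≡⟨ cong downs (reverseNot-∷ c v) ⟩
  downs (reverseNot v ++ not c ∷ [])     ≡⟨ downs-++ (reverseNot v) (not c ∷ []) ⟩
  downs (reverseNot v) + (𝟙 (not (not c)) + 0)
    ≡⟨ cong₂ _+_ (downs-reverseNot v) (trans (+-identityʳ _) (cong 𝟙 (not-involutive c))) ⟩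
  ups v + 𝟙 c                            ≡⟨ +-comm (ups v) (𝟙 c) ⟩
  ups (c ∷ v)                            ∎
  where open ≡-Reasoning

endsUp : List Bool → Bool
endsUp []            = false
endsUp (c ∷ [])      = c
endsUp (c ∷ c′ ∷ cs) = endsUp (c′ ∷ cs)

endsUp-∷ʳ : (v : List Bool) (c : Bool) → endsUp (v ++ c ∷ []) ≡ c
endsUp-∷ʳ []            c = refl
endsUp-∷ʳ (c′ ∷ [])     c = refl
endsUp-∷ʳ (c′ ∷ c″ ∷ v) c = endsUp-∷ʳ (c″ ∷ v) c

peaks-++ : (v : List Bool) (c : Bool) (w : List Bool) →
  peaks (v ++ c ∷ w) ≡ peaks v + 𝟙 (endsUp v ∧ not c) + peaks (c ∷ w)
peaks-++ []            c w = refl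
peaks-++ (c₁ ∷ [])     c w = refl
peaks-++ (c₁ ∷ c₂ ∷ v) c w = begin
  p₁ + peaks (c₂ ∷ v ++ c ∷ w)                                          ≡⟨ cong (p₁ +_) (peaks-++ (c₂ ∷ v) c w) ⟩
  p₁ + (peaks (c₂ ∷ v) + 𝟙 (endsUp (c₂ ∷ v) ∧ not c) + peaks (c ∷ w))   ≡⟨ +-assoc p₁ _ _ ⟨
  p₁ + (peaks (c₂ ∷ v) + 𝟙 (endsUp (c₂ ∷ v) ∧ not c)) + peaks (c ∷ w)   ≡⟨ cong (_+ peaks (c ∷ w)) (+-assoc p₁ _ _) ⟨
  peaks (c₁ ∷ c₂ ∷ v) + 𝟙 (endsUp (c₂ ∷ v) ∧ not c) + peaks (c ∷ w)    ∎
  where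
  open ≡-Reasoning
  p₁ = 𝟙 (c₁ ∧ not c₂)

peaks-reverseNot : (v : List Bool) → peaks (reverseNot v) ≡ peaks v
peaks-reverseNot []           = refl
peaks-reverseNot (c ∷ [])     = refl
peaks-reverseNot (c ∷ c′ ∷ v) = begin
  peaks (reverseNot (c ∷ c′ ∷ v))                                         ≡⟨ cong peaks (reverseNot-∷ c (c′ ∷ v)) ⟩
  peaks (reverseNot (c′ ∷ v) ++ not c ∷ [])                                ≡⟨ peaks-++ (reverseNot (c′ ∷ v)) (not c) [] ⟩
  peaks (reverseNot (c′ ∷ v)) + 𝟙 (endsUp (reverseNot (c′ ∷ v)) ∧ not (not c)) + 0
    ≡⟨ +-identityʳ _ ⟩
  peaks (reverseNot (c′ ∷ v)) + 𝟙 (endsUp (reverseNot (c′ ∷ v)) ∧ not (not c))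
    ≡⟨ cong₂ _+_ (peaks-reverseNot (c′ ∷ v))
                 (cong 𝟙 (cong₂ _∧_ (trans (cong endsUp (reverseNot-∷ c′ v)) (endsUp-∷ʳ (reverseNot v) (not c′)))
                                    (not-involutive c))) ⟩
  peaks (c′ ∷ v) + 𝟙 (not c′ ∧ c)
    ≡⟨ +-comm (peaks (c′ ∷ v)) _ ⟩
  𝟙 (not c′ ∧ c) + peaks (c′ ∷ v)
    ≡⟨ cong (λ b → 𝟙 b + peaks (c′ ∷ v)) (∧-comm (not c′) c) ⟩
  peaks (c ∷ c′ ∷ v)
    ∎
  where open ≡-Reasoning

-- Ballotness of reverseNot v read from the left (coballotFrom-reverseNot), so that the cuts of
-- a word can be enumerated letter by letter.
coballotFrom : ℕ → List Bool → Bool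
coballotFrom h       []          = h ≡ᵇ 0
coballotFrom h       (true ∷ v)  = coballotFrom (suc h) v
coballotFrom zero    (false ∷ v) = coballotFrom zero v
coballotFrom (suc h) (false ∷ v) = coballotFrom h v

coballotFrom-endsDown : (h : ℕ) (v : List Bool) → coballotFrom h v ≡ true → endsUp v ≡ false
coballotFrom-endsDown h       []               _  = refl
coballotFrom-endsDown h       (false ∷ [])     _  = refl
coballotFrom-endsDown h       (true ∷ c ∷ v)   cb = coballotFrom-endsDown (suc h) (c ∷ v) cb
coballotFrom-endsDown zero    (false ∷ c ∷ v) cb = coballotFrom-endsDown zero (c ∷ v) cb
coballotFrom-endsDown (suc h) (false ∷ c ∷ v) cb = coballotFrom-endsDown h (c ∷ v) cb

finalHeight : ℕ → List Bool → ℕ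
finalHeight h       []          = h
finalHeight h       (true ∷ u)  = finalHeight (suc h) u
finalHeight zero    (false ∷ u) = finalHeight zero u
finalHeight (suc h) (false ∷ u) = finalHeight h u

ballotFrom-++ : (h : ℕ) (xs ys : List Bool) → ballotFrom h (xs ++ ys) ≡ ballotFrom h xs ∧ ballotFrom (finalHeight h xs) ys
ballotFrom-++ h       []           ys = refl
ballotFrom-++ h       (true ∷ xs)  ys = ballotFrom-++ (suc h) xs ys
ballotFrom-++ zero    (false ∷ xs) ys = refl
ballotFrom-++ (suc h) (false ∷ xs) ys = ballotFrom-++ h xs ys

finalHeight-++ : (h : ℕ) (xs ys : List Bool) → finalHeight h (xs ++ ys) ≡ finalHeight (finalHeight h xs) ys
finalHeight-++ h       []           ys = refl
finalHeight-++ h       (true ∷ xs)  ys = finalHeight-++ (suc h) xs ys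
finalHeight-++ zero    (false ∷ xs) ys = finalHeight-++ zero xs ys
finalHeight-++ (suc h) (false ∷ xs) ys = finalHeight-++ h xs ys

coballotFrom-reverseNot : (h : ℕ) (v : List Bool) →
  coballotFrom h v ≡ ballotFrom 0 (reverseNot v) ∧ (h ≤ᵇ finalHeight 0 (reverseNot v))
coballotFrom-reverseNot zero    [] = refl
coballotFrom-reverseNot (suc h) [] = refl
coballotFrom-reverseNot h (c ∷ v)
  rewrite reverseNot-∷ c v | ballotFrom-++ 0 (reverseNot v) (not c ∷ []) | finalHeight-++ 0 (reverseNot v) (not c ∷ [])
  = step h c
  where
  step : ∀ h c → coballotFrom h (c ∷ v)
    ≡ (ballotFrom 0 (reverseNot v) ∧ ballotFrom (finalHeight 0 (reverseNot v)) (not c ∷ []))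
      ∧ (h ≤ᵇ finalHeight (finalHeight 0 (reverseNot v)) (not c ∷ []))
  step h true rewrite coballotFrom-reverseNot (suc h) v with ballotFrom 0 (reverseNot v) | finalHeight 0 (reverseNot v)
  ... | false | _     = refl
  ... | true  | zero  = refl
  ... | true  | suc e = <ᵇ-suc h e
  step zero false rewrite coballotFrom-reverseNot 0 v with ballotFrom 0 (reverseNot v)
  ... | false = refl
  ... | true  = refl
  step (suc h) false rewrite coballotFrom-reverseNot h v with ballotFrom 0 (reverseNot v)
  ... | false = refl
  ... | true  = sym (<ᵇ-suc h (finalHeight 0 (reverseNot v)))

coballot≡ballot-reverseNot : (v : List Bool) → coballotFrom 0 v ≡ ballotFrom 0 (reverseNot v)
coballot≡ballot-reverseNot v = trans (coballotFrom-reverseNot 0 v) (∧-identityʳ _)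

-- Counting the cuts of a word

∑cuts : (List Bool → List Bool → ℕ) → List Bool → ℕ
∑cuts φ u = ∑ (upTo (suc (length u))) (λ l → cut l φ u)

∑cuts-[] : (φ : List Bool → List Bool → ℕ) → ∑cuts φ [] ≡ φ [] []
∑cuts-[] φ = +-identityʳ (φ [] [])

∑cuts-∷ : (φ : List Bool → List Bool → ℕ) (c : Bool) (u : List Bool) →
  ∑cuts φ (c ∷ u) ≡ φ [] (c ∷ u) + ∑cuts (λ v r → φ (c ∷ v) r) u
∑cuts-∷ φ c u = ∑-upTo-suc (suc (length u)) (λ l → cut l φ (c ∷ u))

∑cuts-cong : (u : List Bool) {φ ψ : List Bool → List Bool → ℕ} → (∀ v r → φ v r ≡ ψ v r) → ∑cuts φ u ≡ ∑cuts ψ u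
∑cuts-cong u φ≗ψ = ∑-cong (upTo (suc (length u))) (λ l → φ≗ψ (take l u) (drop l u))

∑cuts-+ : (φ ψ : List Bool → List Bool → ℕ) (u : List Bool) → ∑cuts (λ v r → φ v r + ψ v r) u ≡ ∑cuts φ u + ∑cuts ψ u
∑cuts-+ φ ψ u = ∑-+ (upTo (suc (length u))) (λ l → cut l φ u) (λ l → cut l ψ u)

afterDescent afterAscent : List Bool → Bool
afterDescent []          = false
afterDescent (true ∷ w)  = false
afterDescent (false ∷ w) = ballotFrom 0 w
afterAscent []          = true
afterAscent (true ∷ w)  = ballotFrom 0 w
afterAscent (false ∷ w) = false

descentCut ascentCut : ℕ → List Bool → List Bool → ℕ
descentCut h v r = 𝟙 (coballotFrom h v ∧ afterDescent r)
ascentCut  h v r = 𝟙 (coballotFrom h v ∧ afterAscent r)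

ballot+descentCuts : (h : ℕ) (u : List Bool) → 𝟙 (ballotFrom h u) + ∑cuts (descentCut h) u ≡ 1
ballot+descentCuts h [] =
  cong suc (trans (∑cuts-[] (descentCut h)) (cong 𝟙 (∧-zeroʳ (coballotFrom h []))))
ballot+descentCuts h (true ∷ u) = begin
  𝟙 (ballotFrom (suc h) u) + ∑cuts (descentCut h) (true ∷ u)
    ≡⟨ cong (𝟙 (ballotFrom (suc h) u) +_) (∑cuts-∷ (descentCut h) true u) ⟩
  𝟙 (ballotFrom (suc h) u) + (𝟙 (coballotFrom h [] ∧ false) + ∑cuts (descentCut (suc h)) u)
    ≡⟨ cong (λ b → 𝟙 (ballotFrom (suc h) u) + (𝟙 b + ∑cuts (descentCut (suc h)) u)) (∧-zeroʳ (coballotFrom h [])) ⟩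
  𝟙 (ballotFrom (suc h) u) + ∑cuts (descentCut (suc h)) u
    ≡⟨ ballot+descentCuts (suc h) u ⟩
  1
    ∎
  where open ≡-Reasoning
ballot+descentCuts zero (false ∷ u) = trans (∑cuts-∷ (descentCut 0) false u) (ballot+descentCuts 0 u)
ballot+descentCuts (suc h) (false ∷ u) =
  trans (cong (𝟙 (ballotFrom h u) +_) (∑cuts-∷ (descentCut (suc h)) false u)) (ballot+descentCuts h u)

depth : List Bool → ℕ
depth []          = 0
depth (true ∷ u)  = depth u ∸ 1
depth (false ∷ u) = suc (depth u)

ballotFrom-depth : (h : ℕ) (u : List Bool) → ballotFrom h u ≡ (depth u ≤ᵇ h)
ballotFrom-depth h       []          = refl
ballotFrom-depth h       (true ∷ u)  with depth u | ballotFrom-depth (suc h) u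
... | zero  | b≡ = b≡
... | suc d | b≡ = trans b≡ (<ᵇ-suc d h)
ballotFrom-depth zero    (false ∷ u) = refl
ballotFrom-depth (suc h) (false ∷ u) = trans (ballotFrom-depth h u) (sym (<ᵇ-suc (depth u) h))

ascentCuts : (h : ℕ) (u : List Bool) → ∑cuts (ascentCut h) u ≡ 𝟙 (h ≤ᵇ depth u)
ascentCuts zero    []          = refl
ascentCuts (suc h) []          = refl
ascentCuts h       (true ∷ u)  = begin
  ∑cuts (ascentCut h) (true ∷ u)
    ≡⟨ ∑cuts-∷ (ascentCut h) true u ⟩
  𝟙 ((h ≡ᵇ 0) ∧ ballotFrom 0 u) + ∑cuts (ascentCut (suc h)) u
    ≡⟨ cong₂ _+_ (cong (λ b → 𝟙 ((h ≡ᵇ 0) ∧ b)) (ballotFrom-depth 0 u)) (ascentCuts (suc h) u) ⟩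
  𝟙 ((h ≡ᵇ 0) ∧ (depth u ≤ᵇ 0)) + 𝟙 (suc h ≤ᵇ depth u)
    ≡⟨ arith h (depth u) ⟩
  𝟙 (h ≤ᵇ depth u ∸ 1)
    ∎
  where
  open ≡-Reasoning
  arith : ∀ h d → 𝟙 ((h ≡ᵇ 0) ∧ (d ≤ᵇ 0)) + 𝟙 (suc h ≤ᵇ d) ≡ 𝟙 (h ≤ᵇ d ∸ 1)
  arith zero    zero    = refl
  arith zero    (suc d) = refl
  arith (suc h) zero    = refl
  arith (suc h) (suc d) = refl
ascentCuts zero    (false ∷ u) = trans (∑cuts-∷ (ascentCut 0) false u) (ascentCuts 0 u)
ascentCuts (suc h) (false ∷ u) =
  trans (∑cuts-∷ (ascentCut (suc h)) false u) (trans (ascentCuts h u) (sym (cong 𝟙 (<ᵇ-suc h (depth u)))))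

Profile : Set
Profile = Bool × ℕ × ℕ

profile : List ℕ → Profile
profile γ = isBallot γ , pk γ , des γ

wordProfile coProfile : List Bool → Profile
wordProfile u = ballotFrom 0 u , peaks u , downs u
coProfile v = coballotFrom 0 v , peaks v , ups v

profile-updown : (γ : List ℕ) → Unique γ → profile γ ≡ wordProfile (updown γ)
profile-updown γ γ! = cong₂ _,_ (isBallot-updown γ γ!) (cong₂ _,_ (pk-updown γ γ!) (des-updown γ γ!))

wordProfile-reverseNot : (v : List Bool) → wordProfile (reverseNot v) ≡ coProfile v
wordProfile-reverseNot v =
  cong₂ _,_ (sym (coballot≡ballot-reverseNot v)) (cong₂ _,_ (peaks-reverseNot v) (downs-reverseNot v))

-- The summand of the theorem at i = pk ρ and j = des ρ, for ρ the reversed prefix and β the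
-- suffix, with des β = d − l + j written as des β + l = d + j.
cutCondition : ℕ → ℕ → ℕ → Profile → Profile → Bool
cutCondition k d l (b₁ , p₁ , d₁) (b₂ , p₂ , d₂) = b₁ ∧ (b₂ ∧ ((p₂ + p₁ ≡ᵇ k) ∧ (d₂ + l ≡ᵇ d + d₁)))

cutTerm : ℕ → ℕ → ℕ → List ℕ → ℕ
cutTerm k d l π = 𝟙 (cutCondition k d l (profile (reverse (take l π))) (profile (drop l π)))

-- pk π = k and des π = d − e, stated without truncated subtraction.
pkDesTest : ℕ → ℕ → ℕ → List ℕ → Bool
pkDesTest k d e π = (pk π ≡ᵇ k) ∧ (des π + e ≡ᵇ d)

peaksDownsTest : ℕ → ℕ → ℕ → List Bool → Bool
peaksDownsTest k d e u = (peaks u ≡ᵇ k) ∧ (downs u + e ≡ᵇ d)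

wordCutTerm : ℕ → ℕ → List Bool → List Bool → ℕ
wordCutTerm k d v r = 𝟙 (cutCondition k d (suc (length v)) (coProfile v) (wordProfile (drop 1 r)))

cutTerm-zero : (k d : ℕ) (π : List ℕ) → Unique π →
  cutTerm k d 0 π ≡ 𝟙 (ballotFrom 0 (updown π)) * 𝟙 (peaksDownsTest k d 0 (updown π))
cutTerm-zero k d π π! = begin
  𝟙 (isBallot π ∧ ((pk π + 0 ≡ᵇ k) ∧ (des π + 0 ≡ᵇ d + 0)))
    ≡⟨ cong (λ (b , p , e) → 𝟙 (b ∧ ((p + 0 ≡ᵇ k) ∧ (e + 0 ≡ᵇ d + 0)))) (profile-updown π π!) ⟩
  𝟙 (ballotFrom 0 u ∧ ((peaks u + 0 ≡ᵇ k) ∧ (downs u + 0 ≡ᵇ d + 0)))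
    ≡⟨ cong₂ (λ p d′ → 𝟙 (ballotFrom 0 u ∧ ((p ≡ᵇ k) ∧ (downs u + 0 ≡ᵇ d′)))) (+-identityʳ (peaks u)) (+-identityʳ d) ⟩
  𝟙 (ballotFrom 0 u ∧ peaksDownsTest k d 0 u)
    ≡⟨ 𝟙-∧ (ballotFrom 0 u) (peaksDownsTest k d 0 u) ⟩
  𝟙 (ballotFrom 0 u) * 𝟙 (peaksDownsTest k d 0 u)
    ∎
  where
  open ≡-Reasoning
  u = updown π

cutTerm-suc : (k d x : ℕ) (π : List ℕ) (l : ℕ) → Unique (x ∷ π) → l ≤ length π →
  cutTerm k d (suc l) (x ∷ π) ≡ wordCutTerm k d (take l (updown (x ∷ π))) (drop l (updown (x ∷ π)))
cutTerm-suc k d x π l xπ! l≤ =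
  cong 𝟙 (cong₂ (λ m (P , Q) → cutCondition k d m P Q) (cong suc (sym |v|)) (cong₂ _,_ reversed rest))
  where
  u = updown (x ∷ π)
  α = take (suc l) (x ∷ π)
  |v| : length (take l u) ≡ l
  |v| = trans (length-take l u) (m≤n⇒m⊓n≡m (subst (l ≤_) (sym (length-updown x π)) l≤))
  reversed : profile (reverse α) ≡ coProfile (take l u)
  reversed = begin
    profile (reverse α)                    ≡⟨ profile-updown (reverse α) (Unique-reverse (Unique.take⁺ (suc l) xπ!)) ⟩
    wordProfile (updown (reverse α))       ≡⟨ cong wordProfile (updown-reverse α (Unique.take⁺ (suc l) xπ!)) ⟩
    wordProfile (reverseNot (updown α))    ≡⟨ cong (wordProfile ∘ reverseNot) (updown-take l (x ∷ π)) ⟩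
    wordProfile (reverseNot (take l u))    ≡⟨ wordProfile-reverseNot (take l u) ⟩
    coProfile (take l u)                   ∎
    where open ≡-Reasoning
  rest : profile (drop (suc l) (x ∷ π)) ≡ wordProfile (drop 1 (drop l u))
  rest = begin
    profile (drop (suc l) (x ∷ π))               ≡⟨ profile-updown (drop (suc l) (x ∷ π)) (Unique.drop⁺ (suc l) xπ!) ⟩
    wordProfile (updown (drop (suc l) (x ∷ π)))  ≡⟨ cong wordProfile (updown-drop (suc l) (x ∷ π)) ⟩
    wordProfile (drop (suc l) u)                 ≡⟨ cong (λ m → wordProfile (drop m u)) (+-comm 1 l) ⟩
    wordProfile (drop (l + 1) u)                 ≡⟨ cong wordProfile (drop-drop l 1 u) ⟨
    wordProfile (drop 1 (drop l u))              ∎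
    where open ≡-Reasoning

downs-condition : (d x : ℕ) (v : List Bool) → (x + suc (length v) ≡ᵇ d + ups v) ≡ (downs v + x + 1 ≡ᵇ d)
downs-condition d x v = begin
  (x + suc (length v) ≡ᵇ d + ups v)               ≡⟨ cong (λ m → x + suc m ≡ᵇ d + ups v) (sym (ups+downs v)) ⟩
  (x + suc (ups v + downs v) ≡ᵇ d + ups v)        ≡⟨ cong (_≡ᵇ d + ups v) (rearrange x (ups v) (downs v)) ⟩
  (downs v + x + 1 + ups v ≡ᵇ d + ups v)          ≡⟨ ≡ᵇ-+-cancelʳ (downs v + x + 1) d (ups v) ⟩
  (downs v + x + 1 ≡ᵇ d)                          ∎
  where
  open ≡-Reasoning
  rearrange : ∀ x a b → x + suc (a + b) ≡ b + x + 1 + a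
  rearrange = solve-∀

peaks-after-coballot : (v : List Bool) (c : Bool) (w : List Bool) → coballotFrom 0 v ≡ true →
  peaks (v ++ c ∷ w) ≡ peaks v + peaks (c ∷ w)
peaks-after-coballot v c w cb = begin
  peaks (v ++ c ∷ w)                                   ≡⟨ peaks-++ v c w ⟩
  peaks v + 𝟙 (endsUp v ∧ not c) + peaks (c ∷ w)      ≡⟨ cong (λ b → peaks v + 𝟙 (b ∧ not c) + peaks (c ∷ w)) endsDown ⟩
  peaks v + 0 + peaks (c ∷ w)                          ≡⟨ cong (_+ peaks (c ∷ w)) (+-identityʳ (peaks v)) ⟩
  peaks v + peaks (c ∷ w)                              ∎
  where
  open ≡-Reasoning
  endsDown = coballotFrom-endsDown 0 v cb

peaks-join-down : (v w : List Bool) → coballotFrom 0 v ≡ true → peaks v + peaks w ≡ peaks (v ++ false ∷ w)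
peaks-join-down v []      cb = sym (peaks-after-coballot v false [] cb)
peaks-join-down v (c ∷ w) cb = sym (peaks-after-coballot v false (c ∷ w) cb)

peaks-join-up : (v w : List Bool) → coballotFrom 0 v ≡ true → ballotFrom 0 w ≡ true →
  peaks v + peaks w ≡ peaks (v ++ true ∷ w)
peaks-join-up v []          cb _  = sym (peaks-after-coballot v true [] cb)
peaks-join-up v (true ∷ w)  cb _  = sym (peaks-after-coballot v true (true ∷ w) cb)
peaks-join-up v (false ∷ w) cb ()

downs-join-down : (v w : List Bool) → downs v + downs w + 1 ≡ downs (v ++ false ∷ w) + 0
downs-join-down v w = begin
  downs v + downs w + 1    ≡⟨ +-comm (downs v + downs w) 1 ⟩
  suc (downs v + downs w)  ≡⟨ +-suc (downs v) (downs w) ⟨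
  downs v + suc (downs w)  ≡⟨ downs-++ v (false ∷ w) ⟨
  downs (v ++ false ∷ w)   ≡⟨ +-identityʳ _ ⟨
  downs (v ++ false ∷ w) + 0 ∎
  where open ≡-Reasoning

downs-join-up : (v w : List Bool) → downs v + downs w + 1 ≡ downs (v ++ true ∷ w) + 1
downs-join-up v w = cong (_+ 1) (sym (downs-++ v (true ∷ w)))

cutCondition-join : (k d e : ℕ) (v w u : List Bool) → peaks v + peaks w ≡ peaks u → downs v + downs w + 1 ≡ downs u + e →
  ((peaks w + peaks v ≡ᵇ k) ∧ (downs w + suc (length v) ≡ᵇ d + ups v)) ≡ peaksDownsTest k d e u
cutCondition-join k d e v w u p≡ d≡ = cong₂ _∧_
  (cong (_≡ᵇ k) (trans (+-comm (peaks w) (peaks v)) p≡))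
  (trans (downs-condition d (downs w) v) (cong (_≡ᵇ d) d≡))

wordCutTerm-split : (k d : ℕ) (v r : List Bool) →
  wordCutTerm k d v r
    ≡ descentCut 0 v r * 𝟙 (peaksDownsTest k d 0 (v ++ r)) + ascentCut 0 v r * 𝟙 (peaksDownsTest k d 1 (v ++ r))
wordCutTerm-split k d v r with coballotFrom 0 v in cb
... | false = refl
wordCutTerm-split k d v [] | true =
  trans (cong 𝟙 (cutCondition-join k d 1 v [] (v ++ []) peaks≡ downs≡)) (sym (*-identityˡ _))
  where
  peaks≡ : peaks v + 0 ≡ peaks (v ++ [])
  peaks≡ = trans (+-identityʳ (peaks v)) (cong peaks (sym (++-identityʳ v)))
  downs≡ : downs v + 0 + 1 ≡ downs (v ++ []) + 1
  downs≡ = cong (_+ 1) (trans (+-identityʳ (downs v)) (cong downs (sym (++-identityʳ v))))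
wordCutTerm-split k d v (false ∷ w) | true with ballotFrom 0 w in bw
... | false = refl
... | true = trans (cong 𝟙 (cutCondition-join k d 0 v w (v ++ false ∷ w) (peaks-join-down v w cb) (downs-join-down v w)))
                   (sym (trans (+-identityʳ _) (*-identityˡ _)))
wordCutTerm-split k d v (true ∷ w) | true with ballotFrom 0 w in bw
... | false = refl
... | true = trans (cong 𝟙 (cutCondition-join k d 1 v w (v ++ true ∷ w) (peaks-join-up v w cb bw) (downs-join-up v w)))
                   (sym (*-identityˡ _))

∑cuts-factor : (φ : List Bool → List Bool → ℕ) (F : List Bool → ℕ) (u : List Bool) →
  ∑cuts (λ v r → φ v r * F (v ++ r)) u ≡ ∑cuts φ u * F u
∑cuts-factor φ F u = trans
  (∑-cong (upTo (suc (length u))) (λ l → cong (λ u′ → cut l φ u * F u′) (take++drop≡id l u)))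
  (∑-*ʳ (upTo (suc (length u))) (F u) (λ l → cut l φ u))

ballot+wordCutTerms : (k d : ℕ) (u : List Bool) →
  𝟙 (ballotFrom 0 u) * 𝟙 (peaksDownsTest k d 0 u) + ∑cuts (wordCutTerm k d) u
    ≡ 𝟙 (peaksDownsTest k d 0 u) + 𝟙 (peaksDownsTest k d 1 u)
ballot+wordCutTerms k d u = begin
  Bal * X u + ∑cuts (wordCutTerm k d) u
    ≡⟨ cong (Bal * X u +_) (∑cuts-cong u (wordCutTerm-split k d)) ⟩
  Bal * X u + ∑cuts (λ v r → descentCut 0 v r * X (v ++ r) + ascentCut 0 v r * Y (v ++ r)) u
    ≡⟨ cong (Bal * X u +_) (∑cuts-+ (λ v r → descentCut 0 v r * X (v ++ r)) (λ v r → ascentCut 0 v r * Y (v ++ r)) u) ⟩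
  Bal * X u + (∑cuts (λ v r → descentCut 0 v r * X (v ++ r)) u + ∑cuts (λ v r → ascentCut 0 v r * Y (v ++ r)) u)
    ≡⟨ cong (Bal * X u +_) (cong₂ _+_ (∑cuts-factor (descentCut 0) X u) (∑cuts-factor (ascentCut 0) Y u)) ⟩
  Bal * X u + (Desc * X u + Asc * Y u)
    ≡⟨ +-assoc (Bal * X u) (Desc * X u) (Asc * Y u) ⟨
  Bal * X u + Desc * X u + Asc * Y u
    ≡⟨ cong (_+ Asc * Y u) (*-distribʳ-+ (X u) Bal Desc) ⟨
  (Bal + Desc) * X u + Asc * Y u
    ≡⟨ cong₂ (λ a c → a * X u + c * Y u) (ballot+descentCuts 0 u) (ascentCuts 0 u) ⟩
  1 * X u + 1 * Y u
    ≡⟨ cong₂ _+_ (*-identityˡ (X u)) (*-identityˡ (Y u)) ⟩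
  X u + Y u
    ∎
  where
  open ≡-Reasoning
  X Y : List Bool → ℕ
  X = 𝟙 ∘ peaksDownsTest k d 0
  Y = 𝟙 ∘ peaksDownsTest k d 1
  Bal = 𝟙 (ballotFrom 0 u)
  Desc = ∑cuts (descentCut 0) u
  Asc = ∑cuts (ascentCut 0) u

peaksDownsTest-updown : (k d e : ℕ) (π : List ℕ) → Unique π → peaksDownsTest k d e (updown π) ≡ pkDesTest k d e π
peaksDownsTest-updown k d e π π! =
  sym (cong₂ (λ p q → (p ≡ᵇ k) ∧ (q + e ≡ᵇ d)) (pk-updown π π!) (des-updown π π!))

cutTerms-nonempty : (k d x : ℕ) (π : List ℕ) → Unique (x ∷ π) →
  Σ≤ (length (x ∷ π)) (λ l → cutTerm k d l (x ∷ π)) ≡ 𝟙 (pkDesTest k d 0 (x ∷ π)) + 𝟙 (pkDesTest k d 1 (x ∷ π))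
cutTerms-nonempty k d x π xπ! = begin
  Σ≤ (suc (length π)) (λ l → cutTerm k d l (x ∷ π))
    ≡⟨ ∑-upTo-suc (suc (length π)) (λ l → cutTerm k d l (x ∷ π)) ⟩
  cutTerm k d 0 (x ∷ π) + Σ≤ (length π) (λ l → cutTerm k d (suc l) (x ∷ π))
    ≡⟨ cong₂ _+_ (cutTerm-zero k d (x ∷ π) xπ!)
                 (∑-upTo-cong (suc (length π)) (λ l l≤ → cutTerm-suc k d x π l xπ! (s≤s⁻¹ l≤))) ⟩
  𝟙 (ballotFrom 0 u) * 𝟙 (peaksDownsTest k d 0 u) + Σ≤ (length π) (λ l → cut l (wordCutTerm k d) u)
    ≡⟨ cong (λ m → 𝟙 (ballotFrom 0 u) * 𝟙 (peaksDownsTest k d 0 u) + Σ≤ m (λ l → cut l (wordCutTerm k d) u))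
            (length-updown x π) ⟨
  𝟙 (ballotFrom 0 u) * 𝟙 (peaksDownsTest k d 0 u) + ∑cuts (wordCutTerm k d) u
    ≡⟨ ballot+wordCutTerms k d u ⟩
  𝟙 (peaksDownsTest k d 0 u) + 𝟙 (peaksDownsTest k d 1 u)
    ≡⟨ cong₂ _+_ (cong 𝟙 (peaksDownsTest-updown k d 0 (x ∷ π) xπ!)) (cong 𝟙 (peaksDownsTest-updown k d 1 (x ∷ π) xπ!)) ⟩
  𝟙 (pkDesTest k d 0 (x ∷ π)) + 𝟙 (pkDesTest k d 1 (x ∷ π))
    ∎
  where
  open ≡-Reasoning
  u = updown (x ∷ π)

cutTerms : (k d : ℕ) (π : List ℕ) → Unique π → ¬ ((length π , k , d) ≡ (0 , 0 , 1)) →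
  Σ≤ (length π) (λ l → cutTerm k d l π) ≡ 𝟙 (pkDesTest k d 0 π) + 𝟙 (pkDesTest k d 1 π)
cutTerms (suc k) d               []      _ _  = refl
cutTerms zero    zero            []      _ _  = refl
cutTerms zero    (suc zero)      []      _ ≢1 = ⊥-elim (≢1 refl)
cutTerms zero    (suc (suc d))   []      _ _  = refl
cutTerms k       d               (x ∷ π) π! _ = cutTerms-nonempty k d x π π!

-- Opened only here: in scope earlier, +_ would make sections such as (m +_) ambiguous.
open import Data.Integer using (+_; _-_) renaming (_+_ to _+ℤ_)

⌊⌋≡≡ᵇ : {P : Set} (P? : Dec P) (m n : ℕ) → (P → m ≡ n) → (m ≡ n → P) → ⌊ P? ⌋ ≡ (m ≡ᵇ n)
⌊⌋≡≡ᵇ P? m n to from with P? | m ≡ᵇ n in eq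
... | yes _  | true  = refl
... | yes p  | false = ⊥-elim (subst T eq (≡⇒≡ᵇ m n (to p)))
... | no ¬p  | true  = ⊥-elim (¬p (from (≡ᵇ⇒≡ m n (subst T (sym eq) tt))))
... | no _   | false = refl

+≟+ : (m n : ℕ) → ⌊ + m ≟ℤ + n ⌋ ≡ (m ≡ᵇ n)
+≟+ m n = ⌊⌋≡≡ᵇ (+ m ≟ℤ + n) m n ℤ.+-injective (cong (λ m → + m))

+≟- : (x a m : ℕ) → ⌊ + x ≟ℤ + m - + a ⌋ ≡ (x + a ≡ᵇ m)
+≟- x a m = ⌊⌋≡≡ᵇ (+ x ≟ℤ + m - + a) (x + a) m
  (λ x≡m-a → ℤ.+-injective (trans (ℤ.pos-+ x a) (trans (cong (_+ℤ + a) x≡m-a) (cancel (+ m) (+ a)))))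
  (λ x+a≡m → trans (sym (uncancel (+ x) (+ a))) (cong (λ t → t - + a) (trans (sym (ℤ.pos-+ x a)) (cong (λ m → + m) x+a≡m))))
  where
  cancel : ∀ y z → y - z +ℤ z ≡ y
  cancel = solve-∀ℤ
  uncancel : ∀ y z → y +ℤ z - z ≡ y
  uncancel = solve-∀ℤ

+≟-+ : (x l d c : ℕ) → ⌊ + x ≟ℤ (+ d - + l) +ℤ + c ⌋ ≡ (x + l ≡ᵇ d + c)
+≟-+ x l d c = trans (cong (λ t → ⌊ + x ≟ℤ t ⌋) reassociate) (+≟- x l (d + c))
  where
  swap : ∀ y z w → (y - z) +ℤ w ≡ (y +ℤ w) - z
  swap = solve-∀ℤ
  reassociate : (+ d - + l) +ℤ + c ≡ + (d + c) - + l
  reassociate = trans (swap (+ d) (+ l) (+ c)) (cong (_- + l) (sym (ℤ.pos-+ d c)))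

hasPkDes≡pkDesTest : (k d e : ℕ) (π : List ℕ) → hasPkDes (+ k) (+ d - + e) π ≡ pkDesTest k d e π
hasPkDes≡pkDesTest k d e π = cong₂ _∧_ (+≟+ (pk π) k) (+≟- (des π) e d)

hasPkDes≡pkDesTest₀ : (k d : ℕ) (π : List ℕ) → hasPkDes (+ k) (+ d) π ≡ pkDesTest k d 0 π
hasPkDes≡pkDesTest₀ k d π = cong₂ _∧_ (+≟+ (pk π) k) (trans (+≟+ (des π) d) (cong (_≡ᵇ d) (sym (+-identityʳ (des π)))))

summand : ℕ → ℕ → ℕ → ℕ → ℕ → List ℕ → List ℕ → ℕ
summand k d l i j = ballotPair (+ i) (+ j) (+ k - + i) ((+ d - + l) +ℤ + j)

summand-δ : (k d l i j : ℕ) (α β : List ℕ) →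
  summand k d l i j α β
    ≡ 𝟙 (pk (reverse α) ≡ᵇ i) * (𝟙 (des (reverse α) ≡ᵇ j)
        * (𝟙 (isBallot (reverse α)) * 𝟙 (isBallotWith (+ k - + i) ((+ d - + l) +ℤ + j) β)))
summand-δ k d l i j α β =
  trans (cong (λ t → 𝟙 (isBallot (reverse α) ∧ t) * F) (cong₂ _∧_ (+≟+ (pk (reverse α)) i) (+≟+ (des (reverse α)) j)))
        (𝟙-∧-∧-* (isBallot (reverse α)) (pk (reverse α) ≡ᵇ i) (des (reverse α) ≡ᵇ j) F)
  where
  F = 𝟙 (isBallotWith (+ k - + i) ((+ d - + l) +ℤ + j) β)

∑∑-summand : (n k d l : ℕ) (π : List ℕ) → length π ≡ n →
  Σ≤ n (λ i → Σ≤ n (λ j → cut l (summand k d l i j) π)) ≡ cutTerm k d l π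
∑∑-summand n k d l π refl = begin
  Σ≤ n (λ i → Σ≤ n (λ j → cut l (summand k d l i j) π))
    ≡⟨ ∑-cong [0,n] (λ i → ∑-cong [0,n] (λ j → summand-δ k d l i j (take l π) β)) ⟩
  Σ≤ n (λ i → Σ≤ n (λ j → 𝟙 (a ≡ᵇ i) * (𝟙 (c ≡ᵇ j) * (𝟙 (isBallot ρ) * F i j))))
    ≡⟨ ∑-cong [0,n] (λ i → ∑-*ˡ [0,n] (𝟙 (a ≡ᵇ i)) (λ j → 𝟙 (c ≡ᵇ j) * (𝟙 (isBallot ρ) * F i j))) ⟩
  Σ≤ n (λ i → 𝟙 (a ≡ᵇ i) * Σ≤ n (λ j → 𝟙 (c ≡ᵇ j) * (𝟙 (isBallot ρ) * F i j)))
    ≡⟨ ∑-upTo-δ (suc n) a (λ i → Σ≤ n (λ j → 𝟙 (c ≡ᵇ j) * (𝟙 (isBallot ρ) * F i j))) (s≤s (bounded (pk≤length ρ))) ⟩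
  Σ≤ n (λ j → 𝟙 (c ≡ᵇ j) * (𝟙 (isBallot ρ) * F a j))
    ≡⟨ ∑-upTo-δ (suc n) c (λ j → 𝟙 (isBallot ρ) * F a j) (s≤s (bounded (des≤length ρ))) ⟩
  𝟙 (isBallot ρ) * F a c
    ≡⟨ 𝟙-∧ (isBallot ρ) _ ⟨
  𝟙 (isBallot ρ ∧ (isBallot β ∧ (⌊ + pk β ≟ℤ + k - + a ⌋ ∧ ⌊ + des β ≟ℤ (+ d - + l) +ℤ + c ⌋)))
    ≡⟨ cong₂ (λ s t → 𝟙 (isBallot ρ ∧ (isBallot β ∧ (s ∧ t)))) (+≟- (pk β) a k) (+≟-+ (des β) l d c) ⟩
  cutTerm k d l π
    ∎
  where
  open ≡-Reasoning
  [0,n] = upTo (suc (length π))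
  ρ = reverse (take l π)
  β = drop l π
  a = pk ρ
  c = des ρ
  F : ℕ → ℕ → ℕ
  F i j = 𝟙 (isBallotWith (+ k - + i) ((+ d - + l) +ℤ + j) β)
  bounded : ∀ {s} → s ≤ length ρ → s ≤ length π
  bounded s≤ = ≤-trans s≤ (≤-trans (≤-reflexive (trans (length-reverse (take l π)) (length-take l π))) (m⊓n≤n l (length π)))

∑∑∑-summand : (n k d : ℕ) → ¬ ((n , k , d) ≡ (0 , 0 , 1)) → (π : List ℕ) → Unique π → length π ≡ n →
  Σ≤ n (λ l → Σ≤ n (λ i → Σ≤ n (λ j → cut l (summand k d l i j) π)))
    ≡ 𝟙 (pkDesTest k d 0 π) + 𝟙 (pkDesTest k d 1 π)
∑∑∑-summand n k d ≢001 π π! |π| = begin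
  Σ≤ n (λ l → Σ≤ n (λ i → Σ≤ n (λ j → cut l (summand k d l i j) π)))
    ≡⟨ ∑-cong (upTo (suc n)) (λ l → ∑∑-summand n k d l π |π|) ⟩
  Σ≤ n (λ l → cutTerm k d l π)
    ≡⟨ cong (λ m → Σ≤ m (λ l → cutTerm k d l π)) |π| ⟨
  Σ≤ (length π) (λ l → cutTerm k d l π)
    ≡⟨ cutTerms k d π π! (λ eq → ≢001 (subst (λ m → (m , k , d) ≡ (0 , 0 , 1)) |π| eq)) ⟩
  𝟙 (pkDesTest k d 0 π) + 𝟙 (pkDesTest k d 1 π)
    ∎
  where open ≡-Reasoning

p≡∑pkDesTest : (n k d e : ℕ) → p n (+ k) (+ d - + e) ≡ ∑ (Sn n) (𝟙 ∘ pkDesTest k d e)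
p≡∑pkDesTest n k d e = trans (p-as-∑ n (+ k) (+ d - + e)) (∑-cong (Sn n) (cong 𝟙 ∘ hasPkDes≡pkDesTest k d e))

p≡∑pkDesTest₀ : (n k d : ℕ) → p n (+ k) (+ d) ≡ ∑ (Sn n) (𝟙 ∘ pkDesTest k d 0)
p≡∑pkDesTest₀ n k d = trans (p-as-∑ n (+ k) (+ d)) (∑-cong (Sn n) (cong 𝟙 ∘ hasPkDes≡pkDesTest₀ k d))

theorem3p1 : (n k d : ℕ) → ¬ ((n , k , d) ≡ (0 , 0 , 1)) →
    p n (+ k) (+ d) + p n (+ k) (+ d - + 1)
      ≡ Σ≤ n (λ l → Σ≤ n (λ i → Σ≤ n (λ j →
          (n C l) * b l (+ i) (+ j) * b (n ∸ l) (+ k - + i) ((+ d - + l) +ℤ + j))))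
theorem3p1 n k d ≢001 = begin
  p n (+ k) (+ d) + p n (+ k) (+ d - + 1)
    ≡⟨ cong₂ _+_ (p≡∑pkDesTest₀ n k d) (p≡∑pkDesTest n k d 1) ⟩
  ∑ (Sn n) (𝟙 ∘ pkDesTest k d 0) + ∑ (Sn n) (𝟙 ∘ pkDesTest k d 1)
    ≡⟨ ∑-+ (Sn n) (𝟙 ∘ pkDesTest k d 0) (𝟙 ∘ pkDesTest k d 1) ⟨
  ∑ (Sn n) (λ π → 𝟙 (pkDesTest k d 0 π) + 𝟙 (pkDesTest k d 1 π))
    ≡⟨ ∑-congᴬ (Sn-unique-length n) (λ π (π! , |π|) → ∑∑∑-summand n k d ≢001 π π! |π|) ⟨
  ∑ (Sn n) (λ π → Σ≤ n (λ l → Σ≤ n (λ i → Σ≤ n (λ j → cut l (summand k d l i j) π))))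
    ≡⟨ ∑-swap₃ (Sn n) [0,n] [0,n] [0,n] (λ π l i j → cut l (summand k d l i j) π) ⟩
  Σ≤ n (λ l → Σ≤ n (λ i → Σ≤ n (λ j → ∑ (Sn n) (cut l (summand k d l i j)))))
    ≡⟨ ∑-upTo-cong (suc n) (λ l l≤n → ∑-cong [0,n] (λ i → ∑-cong [0,n] (λ j →
         ballot-product n l (s≤s⁻¹ l≤n) (+ i) (+ j) (+ k - + i) ((+ d - + l) +ℤ + j)))) ⟨
  Σ≤ n (λ l → Σ≤ n (λ i → Σ≤ n (λ j → (n C l) * b l (+ i) (+ j) * b (n ∸ l) (+ k - + i) ((+ d - + l) +ℤ + j))))
    ∎
  where
  open ≡-Reasoning
  [0,n] = upTo (suc n)
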